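{- Let $\Lambda$ be an Eulerian lattice of rank $n$ and $\nu\in\Lambda$ with $\hat0<\nu<\hat1$. Let $\Lambda_\nu=\{\sigma\in\Lambda:\sigma\vee\nu<\hat1\}$ and let $\Lambda'_\nu=\Lambda_\nu\cup\{*\}$, where $*$ is a new element of rank $n$ with $\sigma<*$ exactly for those $\sigma\in\Lambda_\nu$ with $\nu\not\le\sigma$. Then the sum of the weights $\mathrm{wt}(x)$ over all chains $x$ of $\Lambda'_\nu$ that contain $*$ equals \[\sum_{\nu\le\pi<\hat1}\Psi_{[\hat0,\pi)}\cdot\Big((\mathbf a-\mathbf b)^{\rho(\pi,\hat1)-1}-\mathbf a\cdot(\mathbf a-\mathbf b)^{\rho(\pi,\hat1)-2}\cdot\big(1+(-1)^{\rho(\pi,\hat1)}\big)\Big)\cdot\mathbf b,\] where a term with factor $1+(-1)^{\rho(\pi,\hat1)}=0$ is read as zero.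
   Context: Conventions: all posets are finite and graded, have a minimum $\hat0$ of rank $0$, and need not have a maximum. $\rho$ is rank, $\rho(x,y)=\rho(y)-\rho(x)$. For $\Lambda$ of rank $n$, $\hat1$ is a formally adjoined maximum of rank $n+1$; $\Lambda$ is a lattice if $\Lambda\cup\{\hat1\}$ is a lattice, and $\vee$ is the join in $\Lambda\cup\{\hat1\}$. $\Lambda$ is Eulerian if for all $\tau<\pi$ in $\Lambda\cup\{\hat1\}$, $\sum_{\tau\le\sigma\le\pi}(-1)^{\rho(\tau,\sigma)}=0$. Weights: for a chain $x=\{\hat0=\sigma_0<\sigma_1<\cdots<\sigma_k\}$, $\mathrm{wt}(x)=(\mathbf a-\mathbf b)^{\rho(\sigma_0,\sigma_1)-1}\mathbf b(\mathbf a-\mathbf b)^{\rho(\sigma_1,\sigma_2)-1}\mathbf b\cdots\mathbf b(\mathbf a-\mathbf b)^{\rho(\sigma_k,\hat1)-1}$ in noncommuting $\mathbf a,\mathbf b$, where for chains of $\Lambda'_\nu$ the top $\hat1$ has rank $n+1$ and $\rho(*)=n$. The $\mathbf a\mathbf b$-index $\Psi_P$ of a poset $P$ with top $\hat1$ is $\sum_x\mathrm{wt}(x)$ over all chains; for $[\hat0,\pi)=\{\sigma:\sigma<\pi\}$ the top is $\pi$. -}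

module Defs where

open import Data.Bool using (Bool; true; false; _∧_; _∨_; not; if_then_else_; T)
open import Data.Nat as ℕ using (ℕ; zero; suc; _∸_)
open import Data.Fin as Fin using (Fin)
open import Data.Integer as ℤ using (ℤ; +_; -_)
open import Data.List using (List; []; _∷_; _++_; map; concatMap; foldr; allFin; length)
open import Data.Bool.ListAction using (any; all)
open import Data.Product using (_×_; _,_; ∃)
open import Relation.Nullary using (¬_)
open import Relation.Nullary.Decidable using (⌊_⌋)
open import Relation.Binary.PropositionalEquality using (_≡_)

filterᵇ : {A : Set} → (A → Bool) → List A → List A
filterᵇ p [] = []
filterᵇ p (x ∷ xs) = if p x then x ∷ filterᵇ p xs else filterᵇ p xs

sumℤ : List ℤ → ℤ
sumℤ = foldr ℤ._+_ (+ 0)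

listsOf : {A : Set} → ℕ → List A → List (List A)
listsOf zero es = [] ∷ []
listsOf (suc k) es = concatMap (λ x → map (x ∷_) (listsOf k es)) es

listsUpTo : {A : Set} → ℕ → List A → List (List A)
listsUpTo zero es = listsOf zero es
listsUpTo (suc k) es = listsUpTo k es ++ listsOf (suc k) es

-- The free ℤ-algebra ℤ⟨a,b⟩ on two noncommuting variables.
-- A polynomial is a finite formal ℤ-linear combination of words;
-- equality is equality of all coefficients.

data AB : Set where
  𝐚 𝐛 : AB

_≟AB_ : AB → AB → Bool
𝐚 ≟AB 𝐚 = true
𝐛 ≟AB 𝐛 = true
_ ≟AB _ = false

Word : Set
Word = List AB

_≟W_ : Word → Word → Bool
[] ≟W [] = true
(x ∷ u) ≟W (y ∷ v) = (x ≟AB y) ∧ (u ≟W v)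
_ ≟W _ = false

Poly : Set
Poly = List (ℤ × Word)

coeff : Poly → Word → ℤ
coeff [] w = + 0
coeff ((c , u) ∷ p) w = (if u ≟W w then c else + 0) ℤ.+ coeff p w

_≈_ : Poly → Poly → Set
p ≈ q = ∀ w → coeff p w ≡ coeff q w

infix 4 _≈_
infixl 6 _⊕_ _⊖_
infixl 7 _⊗_

zeroP : Poly
zeroP = []

oneP : Poly
oneP = (+ 1 , []) ∷ []

_⊕_ : Poly → Poly → Poly
p ⊕ q = p ++ q

scale : ℤ → Poly → Poly
scale c = map (λ { (d , u) → (c ℤ.* d , u) })

_⊖_ : Poly → Poly → Poly
p ⊖ q = p ⊕ scale (- (+ 1)) q

_⊗_ : Poly → Poly → Poly
p ⊗ q = concatMap (λ { (c , u) → map (λ { (d , v) → (c ℤ.* d , u ++ v) }) q }) p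

_^P_ : Poly → ℕ → Poly
p ^P zero = oneP
p ^P suc k = p ⊗ (p ^P k)

sumP : List Poly → Poly
sumP = foldr _⊕_ zeroP

𝐀 𝐁 𝐀-𝐁 : Poly
𝐀 = (+ 1 , 𝐚 ∷ []) ∷ []
𝐁 = (+ 1 , 𝐛 ∷ []) ∷ []
𝐀-𝐁 = 𝐀 ⊖ 𝐁

increasing : {E : Set} → (E → E → Bool) → E → List E → Bool
increasing lt x [] = true
increasing lt x (y ∷ l) = lt x y ∧ increasing lt y l

wtFrom : {E : Set} → (E → ℕ) → ℕ → E → List E → Poly
wtFrom rk topRank x [] = 𝐀-𝐁 ^P ((topRank ∸ rk x) ∸ 1)
wtFrom rk topRank x (y ∷ l) =
  (𝐀-𝐁 ^P ((rk y ∸ rk x) ∸ 1)) ⊗ 𝐁 ⊗ wtFrom rk topRank y l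

-- The chains σ₀ = bottom < σ₁ < ... < σₖ are represented by the list
-- (σ₁ , ... , σₖ) of elements of es.  chainSum sums wt over those
-- chains satisfying the extra selection predicate sel.
chainSum : {E : Set} → List E → (E → E → Bool) → (E → ℕ) → E → ℕ →
           (List E → Bool) → Poly
chainSum es lt rk bot topRank sel =
  sumP (map (wtFrom rk topRank bot)
            (filterᵇ (λ l → increasing lt bot l ∧ sel l)
                     (listsUpTo (length es) es)))

record FinPoset (N : ℕ) : Set where
  field
    leb : Fin N → Fin N → Bool
    ρ   : Fin N → ℕ
    0̂   : Fin N

module _ {N : ℕ} (P : FinPoset N) where
  open FinPoset P

  _≤Λ_ : Fin N → Fin N → Set
  x ≤Λ y = T (leb x y)

  ltb : Fin N → Fin N → Bool
  ltb x y = leb x y ∧ not ⌊ x Fin.≟ y ⌋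

  IsPartialOrder : Set
  IsPartialOrder =
    (∀ x → x ≤Λ x) ×
    (∀ x y → x ≤Λ y → y ≤Λ x → x ≡ y) ×
    (∀ x y z → x ≤Λ y → y ≤Λ z → x ≤Λ z)

  data Hat : Set where
    elem : Fin N → Hat
    top  : Hat

  hatElems : List Hat
  hatElems = map elem (allFin N) ++ (top ∷ [])

  leH : Hat → Hat → Bool
  leH (elem x) (elem y) = leb x y
  leH (elem x) top = true
  leH top (elem y) = false
  leH top top = true

  eqH : Hat → Hat → Bool
  eqH (elem x) (elem y) = ⌊ x Fin.≟ y ⌋
  eqH top top = true
  eqH _ _ = false

  ltH : Hat → Hat → Bool
  ltH x y = leH x y ∧ not (eqH x y)

  ρH : ℕ → Hat → ℕ
  ρH n (elem x) = ρ x
  ρH n top = suc n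

  Covers : Hat → Hat → Set
  Covers x y = T (ltH x y) × (∀ z → ¬ (T (ltH x z) × T (ltH z y)))

  IsGradedOfRank : ℕ → Set
  IsGradedOfRank n =
    (∀ x → 0̂ ≤Λ x) × (ρ 0̂ ≡ 0) ×
    (∀ x y → Covers x y → ρH n y ≡ suc (ρH n x))

  IsLUB : Hat → Hat → Hat → Set
  IsLUB z x y = T (leH x z) × T (leH y z) ×
                (∀ w → T (leH x w) → T (leH y w) → T (leH z w))

  IsGLB : Hat → Hat → Hat → Set
  IsGLB z x y = T (leH z x) × T (leH z y) ×
                (∀ w → T (leH w x) → T (leH w y) → T (leH w z))

  IsLattice : Set
  IsLattice = ∀ x y → ∃ (λ z → IsLUB z x y) × ∃ (λ z → IsGLB z x y)

  IsEulerian : ℕ → Set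
  IsEulerian n = ∀ τ π → T (ltH τ π) →
    sumℤ (map (λ σ → (- (+ 1)) ℤ.^ (ρH n σ ∸ ρH n τ))
              (filterᵇ (λ σ → leH τ σ ∧ leH σ π) hatElems)) ≡ + 0

  isLUBᵇ : Hat → Hat → Hat → Bool
  isLUBᵇ z x y = leH x z ∧ leH y z ∧
                 all (λ w → not (leH x w ∧ leH y w) ∨ leH z w) hatElems

  -- σ ∈ Λ_ν  iff  σ ∨ ν < 1̂, i.e. the join of σ and ν in Λ ∪ {1̂}
  -- is an element of Λ.
  inΛν : Fin N → Fin N → Bool
  inΛν ν σ = any (λ z → isLUBᵇ (elem z) (elem σ) (elem ν)) (allFin N)

  data Star : Set where
    old  : Fin N → Star
    star : Star

  isStar : Star → Bool
  isStar (old _) = false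
  isStar star = true

  Λ'elems : Fin N → List Star
  Λ'elems ν = star ∷ map old (filterᵇ (inΛν ν) (allFin N))

  lt' : Fin N → Star → Star → Bool
  lt' ν (old σ) (old τ) = ltb σ τ
  lt' ν (old σ) star = inΛν ν σ ∧ not (leb ν σ)
  lt' ν star _ = false

  ρ' : ℕ → Star → ℕ
  ρ' n (old σ) = ρ σ
  ρ' n star = n

  LHS : ℕ → Fin N → Poly
  LHS n ν = chainSum (Λ'elems ν) (lt' ν) (ρ' n) (old 0̂) (suc n) (any isStar)

  -- Ψ of [0̂, π) = {σ : σ < π}, with top π
  Ψbelow : Fin N → Poly
  Ψbelow π = chainSum (filterᵇ (λ σ → ltb σ π) (allFin N)) ltb ρ 0̂ (ρ π) (λ _ → true)

  -- the right-hand side; r = ρ(π, 1̂) = n + 1 - ρ(π)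
  RHSterm : ℕ → Fin N → Poly
  RHSterm n π =
    let r = suc n ∸ ρ π in
    Ψbelow π ⊗
      ((𝐀-𝐁 ^P (r ∸ 1)) ⊖
        scale (+ 1 ℤ.+ (- (+ 1)) ℤ.^ r) (𝐀 ⊗ (𝐀-𝐁 ^P (r ∸ 2))))
      ⊗ 𝐁

  RHS : ℕ → Fin N → Poly
  RHS n ν = sumP (map (RHSterm n) (filterᵇ (leb ν) (allFin N)))

module Submission where

-- For x ∈ Λ_ν let R(x) be the right-hand side with 0̂ replaced by x (π ranges over π ≥ ν with
-- π > x, and Ψ over the chains of [x, π)), and let H(x) be the sum over the chains of Λ'_ν from x
-- through *. Splitting off the first step of every chain gives recursions for both. The bracket
-- is built to telescope: for x < π, the one-element chain of [x, π) followed by the bracket and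
-- b, plus the step (a-b)^(ρ(x,π)-1) b from x to π followed by (1 + (-1)^ρ(π,1̂)) (a-b)^(ρ(π,1̂)-2) b,
-- equals ± (a-b)^(ρ(x,1̂)-2) b. Summing these signs with Euler's relation on [x, 1̂] gives, by
-- downward induction on x,
--   R(x) = (1 + (-1)^ρ(x,1̂)) (a-b)^(ρ(x,1̂)-2) b   if ν ≤ x,
--   R(x) = H(x)                                      if ν ≰ x.
-- In the second case the π counted are exactly those above x ∨ ν < 1̂, whose signs sum to 1 by
-- Euler's relation on [x ∨ ν, 1̂]; this produces the step x → * of H, and the terms through
-- elements y ≥ ν vanish on both sides. The proposition is the case x = 0̂.

open import Defs
open import Data.Bool using (Bool; true; false; _∧_; _∨_; not; if_then_else_; T)
open import Data.Bool.Properties using (∧-zeroʳ; ∧-identityʳ; ∨-assoc; T-≡; T-∧)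
open import Data.Bool.ListAction using (any)
open import Data.Nat as ℕ using (ℕ; zero; suc; _∸_; _≤_; _<_; z≤n; s≤s)
import Data.Nat.Properties as ℕₚ
open import Data.Fin as Fin using (Fin)
open import Data.Integer as ℤ using (ℤ; 0ℤ; 1ℤ; -1ℤ; -_; _+_; _*_)
import Data.Integer.Properties as ℤₚ
open import Data.Integer.Tactic.RingSolver using (solve-∀)
open import Data.List using (List; []; _∷_; _++_; map; concatMap; length; allFin)
import Data.List.Properties as Listₚ
open import Data.List.Membership.Propositional using (_∈_; find; lose)
open import Data.List.Membership.Propositional.Properties
  using (∈-map⁺; ∈-map⁻; ∈-++⁺ˡ; ∈-++⁺ʳ; ∈-allFin; ∈-concatMap⁻)
open import Data.List.Relation.Unary.Any using (here; there; _─_)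
open import Data.List.Relation.Unary.Any.Properties using (any⁺; any⁻)
open import Data.List.Relation.Unary.All as All using (All; []; _∷_)
open import Data.List.Relation.Unary.All.Properties using (all⁺; all⁻)
open import Data.List.Relation.Unary.Unique.Propositional using (Unique; []; _∷_)
open import Data.Product using (_×_; _,_; proj₁; proj₂; ∃)
open import Data.Nat.Induction using (<-wellFounded)
open import Induction.WellFounded using (Acc; acc)
open import Data.Empty using (⊥-elim)
open import Function using (_∘_; Equivalence)
open import Relation.Nullary using (¬_; yes; no)
open import Relation.Nullary.Decidable using (⌊_⌋)
open import Relation.Binary.Bundles using (Setoid)
open import Relation.Binary.Structures using (IsEquivalence)
open import Relation.Binary.PropositionalEquality
import Relation.Binary.Reasoning.Setoid as SetoidReasoning

∑ : {A : Set} → List A → (A → ℤ) → ℤ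
∑ l f = sumℤ (map f l)

∑-cong : {A : Set} (l : List A) {f g : A → ℤ} → (∀ x → f x ≡ g x) → ∑ l f ≡ ∑ l g
∑-cong []      f≡g = refl
∑-cong (x ∷ l) f≡g = cong₂ _+_ (f≡g x) (∑-cong l f≡g)

∑-zero : {A : Set} (l : List A) {f : A → ℤ} → (∀ x → f x ≡ 0ℤ) → ∑ l f ≡ 0ℤ
∑-zero []      f≡0 = refl
∑-zero (x ∷ l) f≡0 = cong₂ _+_ (f≡0 x) (∑-zero l f≡0)

∑-++ : {A : Set} (l m : List A) (f : A → ℤ) → ∑ (l ++ m) f ≡ ∑ l f + ∑ m f
∑-++ []      m f = sym (ℤₚ.+-identityˡ _)
∑-++ (x ∷ l) m f = trans (cong (f x +_) (∑-++ l m f)) (sym (ℤₚ.+-assoc (f x) _ _))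

∑-map : {A B : Set} (l : List A) (g : A → B) (f : B → ℤ) → ∑ (map g l) f ≡ ∑ l (f ∘ g)
∑-map []      g f = refl
∑-map (x ∷ l) g f = cong (f (g x) +_) (∑-map l g f)

∑-distrib-+ : {A : Set} (l : List A) (f g : A → ℤ) → ∑ l (λ x → f x + g x) ≡ ∑ l f + ∑ l g
∑-distrib-+ []      f g = refl
∑-distrib-+ (x ∷ l) f g = trans (cong ((f x + g x) +_) (∑-distrib-+ l f g)) (interchange (f x) (g x) _ _)
  where
  interchange : ∀ a b c d → (a + b) + (c + d) ≡ (a + c) + (b + d)
  interchange = solve-∀

*-distribˡ-∑ : {A : Set} (c : ℤ) (l : List A) (f : A → ℤ) → c * ∑ l f ≡ ∑ l (λ x → c * f x)
*-distribˡ-∑ c []      f = ℤₚ.*-zeroʳ c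
*-distribˡ-∑ c (x ∷ l) f = trans (ℤₚ.*-distribˡ-+ c (f x) _) (cong (c * f x +_) (*-distribˡ-∑ c l f))

*-distribʳ-∑ : {A : Set} (c : ℤ) (l : List A) (f : A → ℤ) → ∑ l f * c ≡ ∑ l (λ x → f x * c)
*-distribʳ-∑ c l f =
  trans (ℤₚ.*-comm (∑ l f) c) (trans (*-distribˡ-∑ c l f) (∑-cong l (λ x → ℤₚ.*-comm c (f x))))

∑-comm : {A B : Set} (l : List A) (m : List B) (f : A → B → ℤ) →
         ∑ l (λ x → ∑ m (f x)) ≡ ∑ m (λ y → ∑ l (λ x → f x y))
∑-comm []      m f = sym (∑-zero m (λ _ → refl))
∑-comm (x ∷ l) m f =
  trans (cong (∑ m (f x) +_) (∑-comm l m f)) (sym (∑-distrib-+ m (f x) (λ y → ∑ l (λ x' → f x' y))))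

whenℤ : Bool → ℤ → ℤ
whenℤ b c = if b then c else 0ℤ

∑-filter : {A : Set} (p : A → Bool) (l : List A) (f : A → ℤ) → ∑ (filterᵇ p l) f ≡ ∑ l (λ x → whenℤ (p x) (f x))
∑-filter p []      f = refl
∑-filter p (x ∷ l) f with p x
... | true  = cong (f x +_) (∑-filter p l f)
... | false = trans (∑-filter p l f) (sym (ℤₚ.+-identityˡ _))

*-whenℤ : ∀ b c d → c * whenℤ b d ≡ whenℤ b (c * d)
*-whenℤ true  c d = refl
*-whenℤ false c d = ℤₚ.*-zeroʳ c

-- Wrapping _≈_ in a record lets Agda recover p and q from a proof of p ≋ q.
infix 4 _≋_
record _≋_ (p q : Poly) : Set where
  constructor mk≋
  field coeff≡ : p ≈ q
open _≋_ public

≋-isEquivalence : IsEquivalence _≋_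
≋-isEquivalence = record
  { refl  = mk≋ (λ _ → refl)
  ; sym   = λ p≋q → mk≋ (λ w → sym (coeff≡ p≋q w))
  ; trans = λ p≋q q≋r → mk≋ (λ w → trans (coeff≡ p≋q w) (coeff≡ q≋r w))
  }

≋-setoid : Setoid _ _
≋-setoid = record { isEquivalence = ≋-isEquivalence }

open IsEquivalence ≋-isEquivalence public
  using () renaming (refl to ≋-refl; sym to ≋-sym; trans to ≋-trans; reflexive to ≡⇒≋)

module ≋-Reasoning = SetoidReasoning ≋-setoid

coeff-++ : ∀ p q w → coeff (p ++ q) w ≡ coeff p w + coeff q w
coeff-++ []            q w = sym (ℤₚ.+-identityˡ _)
coeff-++ ((c , u) ∷ p) q w =
  trans (cong (whenℤ (u ≟W w) c +_) (coeff-++ p q w)) (sym (ℤₚ.+-assoc (whenℤ (u ≟W w) c) _ _))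

coeff-scale : ∀ c p w → coeff (scale c p) w ≡ c * coeff p w
coeff-scale c []            w = sym (ℤₚ.*-zeroʳ c)
coeff-scale c ((d , u) ∷ p) w =
  trans (cong₂ _+_ (sym (*-whenℤ (u ≟W w) c d)) (coeff-scale c p w)) (sym (ℤₚ.*-distribˡ-+ c _ (coeff p w)))

⊕-cong : ∀ {p p′ q q′} → p ≋ p′ → q ≋ q′ → p ⊕ q ≋ p′ ⊕ q′
⊕-cong {p} {p′} {q} {q′} p≋p′ q≋q′ = mk≋ λ w →
  trans (coeff-++ p q w) (trans (cong₂ _+_ (coeff≡ p≋p′ w) (coeff≡ q≋q′ w)) (sym (coeff-++ p′ q′ w)))

⊕-congˡ : ∀ {p p′} q → p ≋ p′ → p ⊕ q ≋ p′ ⊕ q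
⊕-congˡ q p≋p′ = ⊕-cong p≋p′ (≋-refl {q})

⊕-congʳ : ∀ p {q q′} → q ≋ q′ → p ⊕ q ≋ p ⊕ q′
⊕-congʳ p q≋q′ = ⊕-cong (≋-refl {p}) q≋q′

⊕-assoc : ∀ p q r → (p ⊕ q) ⊕ r ≋ p ⊕ (q ⊕ r)
⊕-assoc p q r = ≡⇒≋ (Listₚ.++-assoc p q r)

⊕-identityʳ : ∀ p → p ⊕ zeroP ≋ p
⊕-identityʳ p = ≡⇒≋ (Listₚ.++-identityʳ p)

scale-cong : ∀ c {p q} → p ≋ q → scale c p ≋ scale c q
scale-cong c {p} {q} p≋q = mk≋ λ w →
  trans (coeff-scale c p w) (trans (cong (c *_) (coeff≡ p≋q w)) (sym (coeff-scale c q w)))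

scale-zero : ∀ p → scale 0ℤ p ≋ zeroP
scale-zero p = mk≋ (coeff-scale 0ℤ p)

scale-identity : ∀ p → scale 1ℤ p ≋ p
scale-identity p = mk≋ λ w → trans (coeff-scale 1ℤ p w) (ℤₚ.*-identityˡ _)

scale-distrib-+ : ∀ c d p → scale c p ⊕ scale d p ≋ scale (c + d) p
scale-distrib-+ c d p = mk≋ λ w → begin
  coeff (scale c p ⊕ scale d p) w        ≡⟨ coeff-++ (scale c p) (scale d p) w ⟩
  coeff (scale c p) w + coeff (scale d p) w ≡⟨ cong₂ _+_ (coeff-scale c p w) (coeff-scale d p w) ⟩
  c * coeff p w + d * coeff p w          ≡⟨ ℤₚ.*-distribʳ-+ (coeff p w) c d ⟨
  (c + d) * coeff p w                    ≡⟨ coeff-scale (c + d) p w ⟨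
  coeff (scale (c + d) p) w              ∎
  where open ≡-Reasoning

scale-assoc : ∀ c d p → scale c (scale d p) ≋ scale (c * d) p
scale-assoc c d p = mk≋ λ w →
  trans (coeff-scale c (scale d p) w) (trans (cong (c *_) (coeff-scale d p w))
    (trans (sym (ℤₚ.*-assoc c d (coeff p w))) (sym (coeff-scale (c * d) p w))))

scale-distrib-⊕ : ∀ c p q → scale c (p ⊕ q) ≋ scale c p ⊕ scale c q
scale-distrib-⊕ c p q = ≡⇒≋ (Listₚ.map-++ _ p q)

scale-inverse : ∀ c p → scale (- c) p ⊕ scale c p ≋ zeroP
scale-inverse c p =
  ≋-trans (scale-distrib-+ (- c) c p) (≋-trans (≡⇒≋ (cong (λ z → scale z p) (ℤₚ.+-inverseˡ c))) (scale-zero p))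

splits : Word → List (Word × Word)
splits []      = ([] , []) ∷ []
splits (x ∷ w) = ([] , x ∷ w) ∷ map (λ s → (x ∷ proj₁ s , proj₂ s)) (splits w)

convolution : Poly → Poly → Word → ℤ
convolution p q w = ∑ (splits w) (λ s → coeff p (proj₁ s) * coeff q (proj₂ s))

∑-splits-monomials : ∀ (u v w : Word) c d →
  ∑ (splits w) (λ s → whenℤ (u ≟W proj₁ s) c * whenℤ (v ≟W proj₂ s) d) ≡ whenℤ ((u ++ v) ≟W w) (c * d)
∑-splits-monomials []      v []      c d = trans (ℤₚ.+-identityʳ _) (*-whenℤ (v ≟W []) c d)
∑-splits-monomials (x ∷ u) v []      c d = refl
∑-splits-monomials []      v (y ∷ w) c d =
  trans (cong (c * whenℤ (v ≟W (y ∷ w)) d +_) (trans (∑-map (splits w) _ _) (∑-zero (splits w) (λ _ → refl))))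
        (trans (ℤₚ.+-identityʳ _) (*-whenℤ (v ≟W (y ∷ w)) c d))
∑-splits-monomials (x ∷ u) v (y ∷ w) c d =
  trans (ℤₚ.+-identityˡ _) (trans (∑-map (splits w) _ _) (same-head x y))
  where
  same-head : ∀ x y →
    ∑ (splits w) (λ s → whenℤ ((x ∷ u) ≟W (y ∷ proj₁ s)) c * whenℤ (v ≟W proj₂ s) d)
      ≡ whenℤ ((x ∷ (u ++ v)) ≟W (y ∷ w)) (c * d)
  same-head 𝐚 𝐚 = ∑-splits-monomials u v w c d
  same-head 𝐛 𝐛 = ∑-splits-monomials u v w c d
  same-head 𝐚 𝐛 = ∑-zero (splits w) (λ _ → refl)
  same-head 𝐛 𝐚 = ∑-zero (splits w) (λ _ → refl)

monomial⊗ : ℤ → Word → Poly → Poly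
monomial⊗ c u = map (λ { (d , v) → (c * d , u ++ v) })

coeff-monomial⊗ : ∀ c u q w →
  coeff (monomial⊗ c u q) w ≡ ∑ (splits w) (λ s → whenℤ (u ≟W proj₁ s) c * coeff q (proj₂ s))
coeff-monomial⊗ c u []            w = sym (∑-zero (splits w) (λ s → ℤₚ.*-zeroʳ (whenℤ (u ≟W proj₁ s) c)))
coeff-monomial⊗ c u ((d , v) ∷ q) w = begin
  whenℤ ((u ++ v) ≟W w) (c * d) + coeff (monomial⊗ c u q) w
    ≡⟨ cong₂ _+_ (sym (∑-splits-monomials u v w c d)) (coeff-monomial⊗ c u q w) ⟩
  ∑ (splits w) (λ s → cu s * whenℤ (v ≟W proj₂ s) d) + ∑ (splits w) (λ s → cu s * coeff q (proj₂ s))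
    ≡⟨ ∑-distrib-+ (splits w) _ _ ⟨
  ∑ (splits w) (λ s → cu s * whenℤ (v ≟W proj₂ s) d + cu s * coeff q (proj₂ s))
    ≡⟨ ∑-cong (splits w) (λ s → sym (ℤₚ.*-distribˡ-+ (cu s) _ _)) ⟩
  ∑ (splits w) (λ s → cu s * coeff ((d , v) ∷ q) (proj₂ s)) ∎
  where
  open ≡-Reasoning
  cu : Word × Word → ℤ
  cu s = whenℤ (u ≟W proj₁ s) c

coeff-⊗ : ∀ p q w → coeff (p ⊗ q) w ≡ convolution p q w
coeff-⊗ []            q w = sym (∑-zero (splits w) (λ s → refl))
coeff-⊗ ((c , u) ∷ p) q w = begin
  coeff (monomial⊗ c u q ++ p ⊗ q) w
    ≡⟨ coeff-++ (monomial⊗ c u q) (p ⊗ q) w ⟩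
  coeff (monomial⊗ c u q) w + coeff (p ⊗ q) w
    ≡⟨ cong₂ _+_ (coeff-monomial⊗ c u q w) (coeff-⊗ p q w) ⟩
  ∑ (splits w) (λ s → whenℤ (u ≟W proj₁ s) c * coeff q (proj₂ s)) + convolution p q w
    ≡⟨ ∑-distrib-+ (splits w) _ _ ⟨
  ∑ (splits w) (λ s → whenℤ (u ≟W proj₁ s) c * coeff q (proj₂ s) + coeff p (proj₁ s) * coeff q (proj₂ s))
    ≡⟨ ∑-cong (splits w) (λ s → sym (ℤₚ.*-distribʳ-+ (coeff q (proj₂ s)) (whenℤ (u ≟W proj₁ s) c) _)) ⟩
  convolution ((c , u) ∷ p) q w ∎
  where open ≡-Reasoning

⊗-cong : ∀ {p p′ q q′} → p ≋ p′ → q ≋ q′ → p ⊗ q ≋ p′ ⊗ q′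
⊗-cong {p} {p′} {q} {q′} p≋p′ q≋q′ = mk≋ λ w → begin
  coeff (p ⊗ q) w     ≡⟨ coeff-⊗ p q w ⟩
  convolution p q w   ≡⟨ ∑-cong (splits w) (λ s → cong₂ _*_ (coeff≡ p≋p′ (proj₁ s)) (coeff≡ q≋q′ (proj₂ s))) ⟩
  convolution p′ q′ w ≡⟨ coeff-⊗ p′ q′ w ⟨
  coeff (p′ ⊗ q′) w   ∎
  where open ≡-Reasoning

⊗-congˡ : ∀ {p p′} q → p ≋ p′ → p ⊗ q ≋ p′ ⊗ q
⊗-congˡ q p≋p′ = ⊗-cong p≋p′ (≋-refl {q})

⊗-congʳ : ∀ p {q q′} → q ≋ q′ → p ⊗ q ≋ p ⊗ q′
⊗-congʳ p q≋q′ = ⊗-cong (≋-refl {p}) q≋q′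

⊗-distribˡ-⊕ : ∀ p q r → p ⊗ (q ⊕ r) ≋ p ⊗ q ⊕ p ⊗ r
⊗-distribˡ-⊕ p q r = mk≋ λ w → begin
  coeff (p ⊗ (q ⊕ r)) w
    ≡⟨ coeff-⊗ p (q ⊕ r) w ⟩
  convolution p (q ⊕ r) w
    ≡⟨ ∑-cong (splits w) (λ s → trans (cong (coeff p (proj₁ s) *_) (coeff-++ q r (proj₂ s)))
                                     (ℤₚ.*-distribˡ-+ (coeff p (proj₁ s)) (coeff q (proj₂ s)) (coeff r (proj₂ s)))) ⟩
  ∑ (splits w) (λ s → coeff p (proj₁ s) * coeff q (proj₂ s) + coeff p (proj₁ s) * coeff r (proj₂ s))
    ≡⟨ ∑-distrib-+ (splits w) _ _ ⟩
  convolution p q w + convolution p r w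
    ≡⟨ cong₂ _+_ (coeff-⊗ p q w) (coeff-⊗ p r w) ⟨
  coeff (p ⊗ q) w + coeff (p ⊗ r) w
    ≡⟨ coeff-++ (p ⊗ q) (p ⊗ r) w ⟨
  coeff (p ⊗ q ⊕ p ⊗ r) w ∎
  where open ≡-Reasoning

⊗-distribʳ-⊕ : ∀ p q r → (p ⊕ q) ⊗ r ≋ p ⊗ r ⊕ q ⊗ r
⊗-distribʳ-⊕ p q r = mk≋ λ w → begin
  coeff ((p ⊕ q) ⊗ r) w
    ≡⟨ coeff-⊗ (p ⊕ q) r w ⟩
  convolution (p ⊕ q) r w
    ≡⟨ ∑-cong (splits w) (λ s → trans (cong (_* coeff r (proj₂ s)) (coeff-++ p q (proj₁ s)))
                                     (ℤₚ.*-distribʳ-+ (coeff r (proj₂ s)) (coeff p (proj₁ s)) (coeff q (proj₁ s)))) ⟩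
  ∑ (splits w) (λ s → coeff p (proj₁ s) * coeff r (proj₂ s) + coeff q (proj₁ s) * coeff r (proj₂ s))
    ≡⟨ ∑-distrib-+ (splits w) _ _ ⟩
  convolution p r w + convolution q r w
    ≡⟨ cong₂ _+_ (coeff-⊗ p r w) (coeff-⊗ q r w) ⟨
  coeff (p ⊗ r) w + coeff (q ⊗ r) w
    ≡⟨ coeff-++ (p ⊗ r) (q ⊗ r) w ⟨
  coeff (p ⊗ r ⊕ q ⊗ r) w ∎
  where open ≡-Reasoning

⊗-zeroʳ : ∀ p → p ⊗ zeroP ≋ zeroP
⊗-zeroʳ p = mk≋ λ w → trans (coeff-⊗ p zeroP w) (∑-zero (splits w) (λ s → ℤₚ.*-zeroʳ (coeff p (proj₁ s))))

⊗-scaleˡ : ∀ c p q → scale c p ⊗ q ≋ scale c (p ⊗ q)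
⊗-scaleˡ c p q = mk≋ λ w → begin
  coeff (scale c p ⊗ q) w
    ≡⟨ coeff-⊗ (scale c p) q w ⟩
  convolution (scale c p) q w
    ≡⟨ ∑-cong (splits w) (λ s → trans (cong (_* coeff q (proj₂ s)) (coeff-scale c p (proj₁ s))) (ℤₚ.*-assoc c _ _)) ⟩
  ∑ (splits w) (λ s → c * (coeff p (proj₁ s) * coeff q (proj₂ s)))
    ≡⟨ *-distribˡ-∑ c (splits w) _ ⟨
  c * convolution p q w
    ≡⟨ cong (c *_) (coeff-⊗ p q w) ⟨
  c * coeff (p ⊗ q) w
    ≡⟨ coeff-scale c (p ⊗ q) w ⟨
  coeff (scale c (p ⊗ q)) w ∎
  where open ≡-Reasoning

⊗-scaleʳ : ∀ c p q → p ⊗ scale c q ≋ scale c (p ⊗ q)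
⊗-scaleʳ c p q = mk≋ λ w → begin
  coeff (p ⊗ scale c q) w
    ≡⟨ coeff-⊗ p (scale c q) w ⟩
  convolution p (scale c q) w
    ≡⟨ ∑-cong (splits w) (λ s → trans (cong (coeff p (proj₁ s) *_) (coeff-scale c q (proj₂ s)))
                                     (x*[c*y]≡c*[x*y] (coeff p (proj₁ s)) _)) ⟩
  ∑ (splits w) (λ s → c * (coeff p (proj₁ s) * coeff q (proj₂ s)))
    ≡⟨ *-distribˡ-∑ c (splits w) _ ⟨
  c * convolution p q w
    ≡⟨ cong (c *_) (coeff-⊗ p q w) ⟨
  c * coeff (p ⊗ q) w
    ≡⟨ coeff-scale c (p ⊗ q) w ⟨
  coeff (scale c (p ⊗ q)) w ∎
  where
  open ≡-Reasoning
  x*[c*y]≡c*[x*y] : ∀ x y → x * (c * y) ≡ c * (x * y)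
  x*[c*y]≡c*[x*y] x y = trans (sym (ℤₚ.*-assoc x c y)) (trans (cong (_* y) (ℤₚ.*-comm x c)) (ℤₚ.*-assoc c x y))

convolution-oneʳ : ∀ (f : Word → ℤ) w → ∑ (splits w) (λ s → f (proj₁ s) * coeff oneP (proj₂ s)) ≡ f w
convolution-oneʳ f []      = trans (ℤₚ.+-identityʳ _) (ℤₚ.*-identityʳ (f []))
convolution-oneʳ f (x ∷ w) =
  trans (cong₂ _+_ (ℤₚ.*-zeroʳ (f [])) (trans (∑-map (splits w) _ _) (convolution-oneʳ (f ∘ (x ∷_)) w)))
        (ℤₚ.+-identityˡ _)

⊗-identityʳ : ∀ p → p ⊗ oneP ≋ p
⊗-identityʳ p = mk≋ λ w → trans (coeff-⊗ p oneP w) (convolution-oneʳ (coeff p) w)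

⊗-identityˡ : ∀ p → oneP ⊗ p ≋ p
⊗-identityˡ p = ≡⇒≋ (trans (Listₚ.++-identityʳ _) (trans (Listₚ.map-cong 1*d p) (Listₚ.map-id p)))
  where
  1*d : ∀ (m : ℤ × Word) → (1ℤ * proj₁ m , proj₂ m) ≡ m
  1*d (d , v) = cong (_, v) (ℤₚ.*-identityˡ d)

⊗-assoc : ∀ p q r → (p ⊗ q) ⊗ r ≋ p ⊗ (q ⊗ r)
⊗-assoc []            q r = ≋-refl
⊗-assoc ((c , u) ∷ p) q r =
  ≋-trans (⊗-distribʳ-⊕ (monomial⊗ c u q) (p ⊗ q) r) (⊕-cong (monomial⊗-assoc q) (⊗-assoc p q r))
  where
  monomial⊗-monomial⊗ : ∀ d v s → monomial⊗ c u (monomial⊗ d v s) ≡ monomial⊗ (c * d) (u ++ v) s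
  monomial⊗-monomial⊗ d v s = trans (sym (Listₚ.map-∘ s))
    (Listₚ.map-cong (λ { (e , x) → cong₂ _,_ (sym (ℤₚ.*-assoc c d e)) (sym (Listₚ.++-assoc u v x)) }) s)
  monomial⊗-assoc : ∀ q → monomial⊗ c u q ⊗ r ≋ monomial⊗ c u (q ⊗ r)
  monomial⊗-assoc []            = ≋-refl
  monomial⊗-assoc ((d , v) ∷ q) =
    ≋-trans (⊕-cong (≡⇒≋ (sym (monomial⊗-monomial⊗ d v r))) (monomial⊗-assoc q))
            (≡⇒≋ (sym (Listₚ.map-++ _ (monomial⊗ d v r) (q ⊗ r))))

⨁ : {A : Set} → List A → (A → Poly) → Poly
⨁ l f = sumP (map f l)

coeff-⨁ : {A : Set} (l : List A) (f : A → Poly) (w : Word) → coeff (⨁ l f) w ≡ ∑ l (λ x → coeff (f x) w)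
coeff-⨁ []      f w = refl
coeff-⨁ (x ∷ l) f w = trans (coeff-++ (f x) (⨁ l f) w) (cong (coeff (f x) w +_) (coeff-⨁ l f w))

⨁-cong-∈ : {A : Set} (l : List A) {f g : A → Poly} → (∀ x → x ∈ l → f x ≋ g x) → ⨁ l f ≋ ⨁ l g
⨁-cong-∈ []      f≋g = ≋-refl
⨁-cong-∈ (x ∷ l) f≋g = ⊕-cong (f≋g x (here refl)) (⨁-cong-∈ l (λ y y∈l → f≋g y (there y∈l)))

⨁-cong : {A : Set} (l : List A) {f g : A → Poly} → (∀ x → f x ≋ g x) → ⨁ l f ≋ ⨁ l g
⨁-cong l f≋g = ⨁-cong-∈ l (λ x _ → f≋g x)

⨁-zero : {A : Set} (l : List A) {f : A → Poly} → (∀ x → f x ≋ zeroP) → ⨁ l f ≋ zeroP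
⨁-zero l f≋0 = mk≋ λ w → trans (coeff-⨁ l _ w) (∑-zero l (λ x → coeff≡ (f≋0 x) w))

⨁-distrib-⊕ : {A : Set} (l : List A) (f g : A → Poly) → ⨁ l (λ x → f x ⊕ g x) ≋ ⨁ l f ⊕ ⨁ l g
⨁-distrib-⊕ l f g = mk≋ λ w → begin
  coeff (⨁ l (λ x → f x ⊕ g x)) w            ≡⟨ coeff-⨁ l _ w ⟩
  ∑ l (λ x → coeff (f x ⊕ g x) w)             ≡⟨ ∑-cong l (λ x → coeff-++ (f x) (g x) w) ⟩
  ∑ l (λ x → coeff (f x) w + coeff (g x) w)   ≡⟨ ∑-distrib-+ l _ _ ⟩
  ∑ l (λ x → coeff (f x) w) + ∑ l (λ x → coeff (g x) w)
                                              ≡⟨ cong₂ _+_ (coeff-⨁ l f w) (coeff-⨁ l g w) ⟨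
  coeff (⨁ l f) w + coeff (⨁ l g) w           ≡⟨ coeff-++ (⨁ l f) (⨁ l g) w ⟨
  coeff (⨁ l f ⊕ ⨁ l g) w                     ∎
  where open ≡-Reasoning

⨁-++ : {A : Set} (l m : List A) (f : A → Poly) → ⨁ (l ++ m) f ≋ ⨁ l f ⊕ ⨁ m f
⨁-++ []      m f = ≋-refl
⨁-++ (x ∷ l) m f = ≋-trans (⊕-congʳ (f x) (⨁-++ l m f)) (≋-sym (⊕-assoc (f x) (⨁ l f) (⨁ m f)))

⨁-map : {A B : Set} (l : List A) (g : A → B) (f : B → Poly) → ⨁ (map g l) f ≡ ⨁ l (f ∘ g)
⨁-map l g f = cong sumP (sym (Listₚ.map-∘ l))

⊗-distribˡ-⨁ : {A : Set} (p : Poly) (l : List A) (f : A → Poly) → p ⊗ ⨁ l f ≋ ⨁ l (λ x → p ⊗ f x)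
⊗-distribˡ-⨁ p []      f = ⊗-zeroʳ p
⊗-distribˡ-⨁ p (x ∷ l) f = ≋-trans (⊗-distribˡ-⊕ p (f x) (⨁ l f)) (⊕-congʳ (p ⊗ f x) (⊗-distribˡ-⨁ p l f))

⊗-distribʳ-⨁ : {A : Set} (p : Poly) (l : List A) (f : A → Poly) → ⨁ l f ⊗ p ≋ ⨁ l (λ x → f x ⊗ p)
⊗-distribʳ-⨁ p []      f = ≋-refl
⊗-distribʳ-⨁ p (x ∷ l) f = ≋-trans (⊗-distribʳ-⊕ (f x) (⨁ l f) p) (⊕-congʳ (f x ⊗ p) (⊗-distribʳ-⨁ p l f))

⨁-comm : {A B : Set} (l : List A) (m : List B) (f : A → B → Poly) →
         ⨁ l (λ x → ⨁ m (f x)) ≋ ⨁ m (λ y → ⨁ l (λ x → f x y))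
⨁-comm l m f = mk≋ λ w → begin
  coeff (⨁ l (λ x → ⨁ m (f x))) w           ≡⟨ coeff-⨁ l _ w ⟩
  ∑ l (λ x → coeff (⨁ m (f x)) w)            ≡⟨ ∑-cong l (λ x → coeff-⨁ m (f x) w) ⟩
  ∑ l (λ x → ∑ m (λ y → coeff (f x y) w))    ≡⟨ ∑-comm l m _ ⟩
  ∑ m (λ y → ∑ l (λ x → coeff (f x y) w))    ≡⟨ ∑-cong m (λ y → coeff-⨁ l (λ x → f x y) w) ⟨
  ∑ m (λ y → coeff (⨁ l (λ x → f x y)) w)    ≡⟨ coeff-⨁ m _ w ⟨
  coeff (⨁ m (λ y → ⨁ l (λ x → f x y))) w   ∎
  where open ≡-Reasoning

⨁-scale : {A : Set} (l : List A) (c : A → ℤ) (p : Poly) → ⨁ l (λ x → scale (c x) p) ≋ scale (∑ l c) p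
⨁-scale l c p = mk≋ λ w → begin
  coeff (⨁ l (λ x → scale (c x) p)) w  ≡⟨ coeff-⨁ l _ w ⟩
  ∑ l (λ x → coeff (scale (c x) p) w)  ≡⟨ ∑-cong l (λ x → coeff-scale (c x) p w) ⟩
  ∑ l (λ x → c x * coeff p w)          ≡⟨ *-distribʳ-∑ (coeff p w) l c ⟨
  ∑ l c * coeff p w                    ≡⟨ coeff-scale (∑ l c) p w ⟨
  coeff (scale (∑ l c) p) w            ∎
  where open ≡-Reasoning

when : Bool → Poly → Poly
when b p = if b then p else zeroP

when-zero : ∀ b → when b zeroP ≋ zeroP
when-zero true  = ≋-refl
when-zero false = ≋-refl

when-cong : ∀ b {p q} → (b ≡ true → p ≋ q) → when b p ≋ when b q
when-cong true  p≋q = p≋q refl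
when-cong false p≋q = ≋-refl

when-false : ∀ b p → b ≢ true → when b p ≋ zeroP
when-false true  p b≢true = ⊥-elim (b≢true refl)
when-false false p b≢true = ≋-refl

⊗-when : ∀ b p q → p ⊗ when b q ≋ when b (p ⊗ q)
⊗-when true  p q = ≋-refl
⊗-when false p q = ⊗-zeroʳ p

when-distrib-⊕ : ∀ b p q → when b (p ⊕ q) ≋ when b p ⊕ when b q
when-distrib-⊕ true  p q = ≋-refl
when-distrib-⊕ false p q = ≋-refl

when-scale : ∀ b c p → when b (scale c p) ≋ scale (whenℤ b c) p
when-scale true  c p = ≋-refl
when-scale false c p = ≋-sym (scale-zero p)

when-⨁ : ∀ b {A : Set} (l : List A) (f : A → Poly) → when b (⨁ l f) ≋ ⨁ l (λ x → when b (f x))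
when-⨁ true  l f = ≋-refl
when-⨁ false l f = ≋-sym (⨁-zero l (λ _ → ≋-refl))

⨁-filter : {A : Set} (p : A → Bool) (l : List A) (f : A → Poly) → ⨁ (filterᵇ p l) f ≋ ⨁ l (λ x → when (p x) (f x))
⨁-filter p []      f = ≋-refl
⨁-filter p (x ∷ l) f with p x
... | true  = ⊕-congʳ (f x) (⨁-filter p l f)
... | false = ⨁-filter p l f

^P-+ : ∀ p a b → p ^P a ⊗ p ^P b ≋ p ^P (a ℕ.+ b)
^P-+ p zero    b = ⊗-identityˡ (p ^P b)
^P-+ p (suc a) b = ≋-trans (⊗-assoc p (p ^P a) (p ^P b)) (⊗-congʳ p (^P-+ p a b))

𝐀≋𝐀-𝐁⊕𝐁 : 𝐀 ≋ 𝐀-𝐁 ⊕ 𝐁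
𝐀≋𝐀-𝐁⊕𝐁 = mk≋ λ w → begin
  coeff 𝐀 w                                ≡⟨ a≡a-b+b (coeff 𝐀 w) (coeff 𝐁 w) ⟩
  (coeff 𝐀 w + -1ℤ * coeff 𝐁 w) + coeff 𝐁 w ≡⟨ cong (λ z → (coeff 𝐀 w + z) + coeff 𝐁 w) (coeff-scale -1ℤ 𝐁 w) ⟨
  (coeff 𝐀 w + coeff (scale -1ℤ 𝐁) w) + coeff 𝐁 w ≡⟨ cong (_+ coeff 𝐁 w) (coeff-++ 𝐀 (scale -1ℤ 𝐁) w) ⟨
  coeff 𝐀-𝐁 w + coeff 𝐁 w                  ≡⟨ coeff-++ 𝐀-𝐁 𝐁 w ⟨
  coeff (𝐀-𝐁 ⊕ 𝐁) w                        ∎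
  where
  open ≡-Reasoning
  a≡a-b+b : ∀ a b → a ≡ (a + -1ℤ * b) + b
  a≡a-b+b = solve-∀

sgn : ℕ → ℤ
sgn k = -1ℤ ℤ.^ k

1+sgn : ℕ → ℤ
1+sgn r = 1ℤ + sgn r

-- The bracket of the formula for r = ρ(π, 1̂). For r = 1 the truncated r ∸ 2 is a junk value,
-- harmless because its coefficient 1+sgn 1 vanishes.
bracket : ℕ → Poly
bracket r = 𝐀-𝐁 ^P (r ∸ 1) ⊖ scale (1+sgn r) (𝐀 ⊗ 𝐀-𝐁 ^P (r ∸ 2))

bracket-1 : bracket 1 ≋ oneP
bracket-1 = ≋-trans (⊕-congʳ oneP (scale-cong -1ℤ (scale-zero (𝐀 ⊗ oneP)))) (⊕-identityʳ oneP)

bracket-2+ : ∀ m → bracket (2 ℕ.+ m) ≋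
  scale (sgn (suc m)) (𝐀-𝐁 ^P suc m) ⊕ scale (- 1+sgn (2 ℕ.+ m)) (𝐁 ⊗ 𝐀-𝐁 ^P m)
bracket-2+ m = begin
  E (suc m) ⊕ scale -1ℤ (scale c (𝐀 ⊗ E m))
    ≈⟨ ⊕-congʳ (E (suc m)) (≋-trans (scale-assoc -1ℤ c _) (scale-cong (-1ℤ * c) 𝐀E≋E⊕𝐁E)) ⟩
  E (suc m) ⊕ scale (-1ℤ * c) (E (suc m) ⊕ 𝐁 ⊗ E m)
    ≈⟨ ⊕-congʳ (E (suc m)) (scale-distrib-⊕ (-1ℤ * c) (E (suc m)) (𝐁 ⊗ E m)) ⟩
  E (suc m) ⊕ (scale (-1ℤ * c) (E (suc m)) ⊕ scale (-1ℤ * c) (𝐁 ⊗ E m))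
    ≈⟨ ⊕-assoc (E (suc m)) _ _ ⟨
  (E (suc m) ⊕ scale (-1ℤ * c) (E (suc m))) ⊕ scale (-1ℤ * c) (𝐁 ⊗ E m)
    ≈⟨ ⊕-cong leading (≡⇒≋ (cong (λ d → scale d (𝐁 ⊗ E m)) (ℤₚ.-1*i≡-i c))) ⟩
  scale (sgn (suc m)) (E (suc m)) ⊕ scale (- c) (𝐁 ⊗ E m) ∎
  where
  open ≋-Reasoning
  E : ℕ → Poly
  E k = 𝐀-𝐁 ^P k
  c : ℤ
  c = 1+sgn (2 ℕ.+ m)
  𝐀E≋E⊕𝐁E : 𝐀 ⊗ E m ≋ E (suc m) ⊕ 𝐁 ⊗ E m
  𝐀E≋E⊕𝐁E = ≋-trans (⊗-congˡ (E m) 𝐀≋𝐀-𝐁⊕𝐁) (⊗-distribʳ-⊕ 𝐀-𝐁 𝐁 (E m))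
  1-c≡sgn : ∀ s → 1ℤ + -1ℤ * (1ℤ + -1ℤ * (-1ℤ * s)) ≡ -1ℤ * s
  1-c≡sgn = solve-∀
  leading : E (suc m) ⊕ scale (-1ℤ * c) (E (suc m)) ≋ scale (sgn (suc m)) (E (suc m))
  leading = ≋-trans (⊕-congˡ _ (≋-sym (scale-identity (E (suc m)))))
    (≋-trans (scale-distrib-+ 1ℤ (-1ℤ * c) (E (suc m))) (≡⇒≋ (cong (λ d → scale d (E (suc m))) (1-c≡sgn (sgn m)))))

bracket-telescope : ∀ j m →
  (𝐀-𝐁 ^P j ⊗ bracket (suc m)) ⊗ 𝐁 ⊕ (𝐀-𝐁 ^P j ⊗ 𝐁) ⊗ scale (1+sgn (suc m)) (𝐀-𝐁 ^P (m ∸ 1) ⊗ 𝐁)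
    ≋ scale (sgn m) (𝐀-𝐁 ^P (j ℕ.+ m) ⊗ 𝐁)
bracket-telescope j zero = begin
  (E j ⊗ bracket 1) ⊗ 𝐁 ⊕ (E j ⊗ 𝐁) ⊗ scale 0ℤ (E 0 ⊗ 𝐁)
    ≈⟨ ⊕-cong (⊗-congˡ 𝐁 (⊗-congʳ (E j) bracket-1)) (⊗-congʳ (E j ⊗ 𝐁) (scale-zero (E 0 ⊗ 𝐁))) ⟩
  (E j ⊗ oneP) ⊗ 𝐁 ⊕ (E j ⊗ 𝐁) ⊗ zeroP
    ≈⟨ ⊕-cong (⊗-congˡ 𝐁 (⊗-identityʳ (E j))) (⊗-zeroʳ (E j ⊗ 𝐁)) ⟩
  E j ⊗ 𝐁 ⊕ zeroP
    ≈⟨ ⊕-identityʳ (E j ⊗ 𝐁) ⟩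
  E j ⊗ 𝐁
    ≈⟨ scale-identity (E j ⊗ 𝐁) ⟨
  scale 1ℤ (E j ⊗ 𝐁)
    ≡⟨ cong (λ k → scale 1ℤ (E k ⊗ 𝐁)) (ℕₚ.+-identityʳ j) ⟨
  scale 1ℤ (E (j ℕ.+ 0) ⊗ 𝐁) ∎
  where
  open ≋-Reasoning
  E : ℕ → Poly
  E k = 𝐀-𝐁 ^P k
bracket-telescope j (suc m) = begin
  (E j ⊗ bracket (2 ℕ.+ m)) ⊗ 𝐁 ⊕ (E j ⊗ 𝐁) ⊗ scale c (E m ⊗ 𝐁)
    ≈⟨ ⊕-cong (⊗-congˡ 𝐁 (⊗-congʳ (E j) (bracket-2+ m))) (⊗-scaleʳ c (E j ⊗ 𝐁) (E m ⊗ 𝐁)) ⟩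
  (E j ⊗ (scale s (E (suc m)) ⊕ scale (- c) (𝐁 ⊗ E m))) ⊗ 𝐁 ⊕ scale c ((E j ⊗ 𝐁) ⊗ (E m ⊗ 𝐁))
    ≈⟨ ⊕-congˡ (scale c Z) (≋-trans (⊗-congˡ 𝐁 (⊗-distribˡ-⊕ (E j) P Q)) (⊗-distribʳ-⊕ (E j ⊗ P) (E j ⊗ Q) 𝐁)) ⟩
  (E j ⊗ scale s (E (suc m))) ⊗ 𝐁 ⊕ (E j ⊗ scale (- c) (𝐁 ⊗ E m)) ⊗ 𝐁 ⊕ scale c ((E j ⊗ 𝐁) ⊗ (E m ⊗ 𝐁))
    ≈⟨ ⊕-assoc ((E j ⊗ P) ⊗ 𝐁) ((E j ⊗ Q) ⊗ 𝐁) (scale c Z) ⟩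
  (E j ⊗ scale s (E (suc m))) ⊗ 𝐁 ⊕ ((E j ⊗ scale (- c) (𝐁 ⊗ E m)) ⊗ 𝐁 ⊕ scale c ((E j ⊗ 𝐁) ⊗ (E m ⊗ 𝐁)))
    ≈⟨ ⊕-cong leading (⊕-congˡ (scale c Z) middle) ⟩
  scale s (E (j ℕ.+ suc m) ⊗ 𝐁) ⊕ (scale (- c) ((E j ⊗ 𝐁) ⊗ (E m ⊗ 𝐁)) ⊕ scale c ((E j ⊗ 𝐁) ⊗ (E m ⊗ 𝐁)))
    ≈⟨ ⊕-congʳ (scale s (E (j ℕ.+ suc m) ⊗ 𝐁)) (scale-inverse c Z) ⟩
  scale s (E (j ℕ.+ suc m) ⊗ 𝐁) ⊕ zeroP
    ≈⟨ ⊕-identityʳ (scale s (E (j ℕ.+ suc m) ⊗ 𝐁)) ⟩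
  scale s (E (j ℕ.+ suc m) ⊗ 𝐁) ∎
  where
  open ≋-Reasoning
  E : ℕ → Poly
  E k = 𝐀-𝐁 ^P k
  s c : ℤ
  s = sgn (suc m)
  c = 1+sgn (2 ℕ.+ m)
  P Q Z : Poly
  P = scale s (E (suc m))
  Q = scale (- c) (𝐁 ⊗ E m)
  Z = (E j ⊗ 𝐁) ⊗ (E m ⊗ 𝐁)
  leading : (E j ⊗ scale s (E (suc m))) ⊗ 𝐁 ≋ scale s (E (j ℕ.+ suc m) ⊗ 𝐁)
  leading = ≋-trans (⊗-congˡ 𝐁 (≋-trans (⊗-scaleʳ s (E j) (E (suc m))) (scale-cong s (^P-+ 𝐀-𝐁 j (suc m)))))
                    (⊗-scaleˡ s (E (j ℕ.+ suc m)) 𝐁)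
  middle : (E j ⊗ scale (- c) (𝐁 ⊗ E m)) ⊗ 𝐁 ≋ scale (- c) ((E j ⊗ 𝐁) ⊗ (E m ⊗ 𝐁))
  middle = ≋-trans (⊗-congˡ 𝐁 (⊗-scaleʳ (- c) (E j) (𝐁 ⊗ E m))) (≋-trans (⊗-scaleˡ (- c) (E j ⊗ (𝐁 ⊗ E m)) 𝐁) (scale-cong (- c)
    (≋-trans (⊗-congˡ 𝐁 (≋-sym (⊗-assoc (E j) 𝐁 (E m)))) (⊗-assoc (E j ⊗ 𝐁) (E m) 𝐁))))

filterᵇ-++ : {A : Set} (p : A → Bool) (l m : List A) → filterᵇ p (l ++ m) ≡ filterᵇ p l ++ filterᵇ p m
filterᵇ-++ p []      m = refl
filterᵇ-++ p (x ∷ l) m with p x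
... | true  = cong (x ∷_) (filterᵇ-++ p l m)
... | false = filterᵇ-++ p l m

filterᵇ-map : {A B : Set} (p : B → Bool) (g : A → B) (l : List A) → filterᵇ p (map g l) ≡ map g (filterᵇ (p ∘ g) l)
filterᵇ-map p g []      = refl
filterᵇ-map p g (x ∷ l) with p (g x)
... | true  = cong (g x ∷_) (filterᵇ-map p g l)
... | false = filterᵇ-map p g l

filterᵇ-cong : {A : Set} {p q : A → Bool} (l : List A) → (∀ x → p x ≡ q x) → filterᵇ p l ≡ filterᵇ q l
filterᵇ-cong []      p≡q = refl
filterᵇ-cong {q = q} (x ∷ l) p≡q rewrite p≡q x with q x
... | true  = cong (x ∷_) (filterᵇ-cong l p≡q)
... | false = filterᵇ-cong l p≡q

filterᵇ-none : {A : Set} (p : A → Bool) (l : List A) → (∀ x → x ∈ l → p x ≡ false) → filterᵇ p l ≡ []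
filterᵇ-none p []      p≡false = refl
filterᵇ-none p (x ∷ l) p≡false rewrite p≡false x (here refl) = filterᵇ-none p l (λ y y∈l → p≡false y (there y∈l))

∈-filterᵇ⁻ : {A : Set} (p : A → Bool) (l : List A) {y : A} → y ∈ filterᵇ p l → p y ≡ true
∈-filterᵇ⁻ p (x ∷ l) y∈ with p x in px
∈-filterᵇ⁻ p (x ∷ l) (here refl) | true  = px
∈-filterᵇ⁻ p (x ∷ l) (there y∈) | true  = ∈-filterᵇ⁻ p l y∈
∈-filterᵇ⁻ p (x ∷ l) y∈          | false = ∈-filterᵇ⁻ p l y∈

∈-listsOf⁻ : {A : Set} (k : ℕ) (es : List A) {l : List A} → l ∈ listsOf k es → All (_∈ es) l × length l ≡ k
∈-listsOf⁻ zero    es (here refl) = [] , refl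
∈-listsOf⁻ (suc k) es l∈ with find (∈-concatMap⁻ (λ y → map (y ∷_) (listsOf k es)) {xs = es} l∈)
... | y , y∈es , l∈ys with ∈-map⁻ (y ∷_) l∈ys
... | l , l∈ , refl with ∈-listsOf⁻ k es l∈
... | l⊆es , |l|≡k = (y∈es ∷ l⊆es) , cong suc |l|≡k

∈-─⁺ : {A : Set} {x y : A} (es : List A) (x∈ : x ∈ es) → y ∈ es → x ≢ y → y ∈ (es ─ x∈)
∈-─⁺ (z ∷ es) (here refl) (here refl) x≢y = ⊥-elim (x≢y refl)
∈-─⁺ (z ∷ es) (here refl) (there y∈)  x≢y = y∈
∈-─⁺ (z ∷ es) (there x∈)  (here refl) x≢y = here refl
∈-─⁺ (z ∷ es) (there x∈)  (there y∈)  x≢y = there (∈-─⁺ es x∈ y∈ x≢y)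

pigeonhole : {A : Set} (l es : List A) → Unique l → All (_∈ es) l → length l ≤ length es
pigeonhole []      es []             []            = z≤n
pigeonhole (x ∷ l) es (x∉l ∷ uniq) (x∈ ∷ l⊆es) = begin
  suc (length l)          ≤⟨ s≤s (pigeonhole l (es ─ x∈) uniq (All.zipWith (λ (x≢y , y∈) → ∈-─⁺ es x∈ y∈ x≢y) (x∉l , l⊆es))) ⟩
  suc (length (es ─ x∈)) ≡⟨ Listₚ.length-removeAt′ es _ ⟨
  length es               ∎
  where open ℕₚ.≤-Reasoning

true≢false : true ≢ false
true≢false ()

T⇒≡true : ∀ {b} → T b → b ≡ true
T⇒≡true = Equivalence.to T-≡

≡true⇒T : ∀ {b} → b ≡ true → T b
≡true⇒T = Equivalence.from T-≡

∧-true⁺ : ∀ {a b} → a ≡ true → b ≡ true → a ∧ b ≡ true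
∧-true⁺ refl refl = refl

∧-true⁻ : ∀ {a b} → a ∧ b ≡ true → a ≡ true × b ≡ true
∧-true⁻ {true} b≡true = refl , b≡true

-- A chain from x is selected when b holds or one of its elements satisfies s; chainSum with
-- selection "any s" is the case b = false, and the sum over all chains is the case b = true.
module ChainSums {E : Set} (es : List E) (lt : E → E → Bool) (rk : E → ℕ) (t : ℕ) (s : E → Bool) where

  step : E → E → Poly
  step x y = 𝐀-𝐁 ^P ((rk y ∸ rk x) ∸ 1) ⊗ 𝐁

  final : E → Poly
  final x = 𝐀-𝐁 ^P ((t ∸ rk x) ∸ 1)

  selected : E → Bool → List E → Bool
  selected x b l = increasing lt x l ∧ (b ∨ any s l)

  sumChainsOfLength : Bool → ℕ → E → Poly
  sumChainsOfLength b k x = ⨁ (filterᵇ (selected x b) (listsOf k es)) (wtFrom rk t x)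

  sumChainsUpTo : Bool → ℕ → E → Poly
  sumChainsUpTo b f x = ⨁ (filterᵇ (selected x b) (listsUpTo f es)) (wtFrom rk t x)

  sumChainsOfLength-zero : ∀ b x → sumChainsOfLength b 0 x ≋ when b (final x)
  sumChainsOfLength-zero true  x = ⊕-identityʳ (final x)
  sumChainsOfLength-zero false x = ≋-refl

  sumChainsOfLength-suc : ∀ b k x →
    sumChainsOfLength b (suc k) x ≋ ⨁ es (λ y → when (lt x y) (step x y ⊗ sumChainsOfLength (b ∨ s y) k y))
  sumChainsOfLength-suc b k x = blocks es
    where
    L = listsOf k es
    block : ∀ y → ⨁ (filterᵇ (selected x b) (map (y ∷_) L)) (wtFrom rk t x)
                    ≋ when (lt x y) (step x y ⊗ sumChainsOfLength (b ∨ s y) k y)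
    block y rewrite filterᵇ-map (selected x b) (y ∷_) L with lt x y
    ... | true  rewrite filterᵇ-cong L (λ l → cong (increasing lt y l ∧_) (sym (∨-assoc b (s y) (any s l)))) =
      ≋-trans (≡⇒≋ (⨁-map (filterᵇ (selected y (b ∨ s y)) L) (y ∷_) (wtFrom rk t x)))
              (≋-sym (⊗-distribˡ-⨁ (step x y) (filterᵇ (selected y (b ∨ s y)) L) (wtFrom rk t y)))
    ... | false rewrite filterᵇ-none (λ _ → false) L (λ _ _ → refl) = ≋-refl
    blocks : ∀ ys → ⨁ (filterᵇ (selected x b) (concatMap (λ y → map (y ∷_) L) ys)) (wtFrom rk t x)
                    ≋ ⨁ ys (λ y → when (lt x y) (step x y ⊗ sumChainsOfLength (b ∨ s y) k y))
    blocks []       = ≋-refl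
    blocks (y ∷ ys) rewrite filterᵇ-++ (selected x b) (map (y ∷_) L) (concatMap (λ y → map (y ∷_) L) ys) =
      ≋-trans (⨁-++ (filterᵇ (selected x b) (map (y ∷_) L)) _ (wtFrom rk t x)) (⊕-cong (block y) (blocks ys))

  sumChainsUpTo-split : ∀ b f x → sumChainsUpTo b (suc f) x ≋ sumChainsUpTo b f x ⊕ sumChainsOfLength b (suc f) x
  sumChainsUpTo-split b f x rewrite filterᵇ-++ (selected x b) (listsUpTo f es) (listsOf (suc f) es) =
    ⨁-++ (filterᵇ (selected x b) (listsUpTo f es)) _ (wtFrom rk t x)

  sumChainsUpTo-suc : ∀ b f x →
    sumChainsUpTo b (suc f) x ≋ when b (final x) ⊕ ⨁ es (λ y → when (lt x y) (step x y ⊗ sumChainsUpTo (b ∨ s y) f y))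
  sumChainsUpTo-suc b zero x =
    ≋-trans (sumChainsUpTo-split b 0 x) (⊕-cong (sumChainsOfLength-zero b x) (sumChainsOfLength-suc b 0 x))
  sumChainsUpTo-suc b (suc f) x = begin
    sumChainsUpTo b (2 ℕ.+ f) x
      ≈⟨ sumChainsUpTo-split b (suc f) x ⟩
    sumChainsUpTo b (suc f) x ⊕ sumChainsOfLength b (2 ℕ.+ f) x
      ≈⟨ ⊕-cong (sumChainsUpTo-suc b f x) (sumChainsOfLength-suc b (suc f) x) ⟩
    (when b (final x) ⊕ ⨁ es (λ y → when (lt x y) (step x y ⊗ sumChainsUpTo (b ∨ s y) f y)))
      ⊕ ⨁ es (λ y → when (lt x y) (step x y ⊗ sumChainsOfLength (b ∨ s y) (suc f) y))
      ≈⟨ ⊕-assoc (when b (final x)) _ _ ⟩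
    when b (final x) ⊕ (⨁ es (λ y → when (lt x y) (step x y ⊗ sumChainsUpTo (b ∨ s y) f y))
      ⊕ ⨁ es (λ y → when (lt x y) (step x y ⊗ sumChainsOfLength (b ∨ s y) (suc f) y)))
      ≈⟨ ⊕-congʳ (when b (final x)) (≋-trans (≋-sym (⨁-distrib-⊕ es _ _)) (⨁-cong es merge)) ⟩
    when b (final x) ⊕ ⨁ es (λ y → when (lt x y) (step x y ⊗ sumChainsUpTo (b ∨ s y) (suc f) y)) ∎
    where
    open ≋-Reasoning
    merge : ∀ y → when (lt x y) (step x y ⊗ sumChainsUpTo (b ∨ s y) f y)
                    ⊕ when (lt x y) (step x y ⊗ sumChainsOfLength (b ∨ s y) (suc f) y)
                  ≋ when (lt x y) (step x y ⊗ sumChainsUpTo (b ∨ s y) (suc f) y)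
    merge y = ≋-trans (≋-sym (when-distrib-⊕ (lt x y) _ _)) (when-cong (lt x y) λ _ →
      ≋-trans (≋-sym (⊗-distribˡ-⊕ (step x y) _ _)) (⊗-congʳ (step x y) (≋-sym (sumChainsUpTo-split (b ∨ s y) f y))))

  LengthBound : E → ℕ → Set
  LengthBound x m = ∀ l → All (_∈ es) l → increasing lt x l ≡ true → length l ≤ m

  sumChainsOfLength-vanishes : ∀ {x m k} b → LengthBound x m → m < k → sumChainsOfLength b k x ≋ zeroP
  sumChainsOfLength-vanishes {x} {m} {k} b bound m<k =
    ≡⇒≋ (cong (λ F → ⨁ F (wtFrom rk t x)) (filterᵇ-none (selected x b) (listsOf k es) not-selected))
    where
    not-selected : ∀ l → l ∈ listsOf k es → selected x b l ≡ false
    not-selected l l∈ with increasing lt x l in inc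
    ... | false = refl
    ... | true with ∈-listsOf⁻ k es l∈
    ... | l⊆es , refl = ⊥-elim (ℕₚ.<⇒≱ m<k (bound l l⊆es inc))

  sumChainsUpTo-stable : ∀ {x m f} b j → LengthBound x m → m ≤ f → sumChainsUpTo b f x ≋ sumChainsUpTo b (f ℕ.+ j) x
  sumChainsUpTo-stable {f = f} b zero    bound m≤f rewrite ℕₚ.+-identityʳ f = ≋-refl
  sumChainsUpTo-stable {x} {f = f} b (suc j) bound m≤f rewrite ℕₚ.+-suc f j = begin
    sumChainsUpTo b f x                                                    ≈⟨ sumChainsUpTo-stable b j bound m≤f ⟩
    sumChainsUpTo b (f ℕ.+ j) x                                            ≈⟨ ⊕-identityʳ _ ⟨
    sumChainsUpTo b (f ℕ.+ j) x ⊕ zeroP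
      ≈⟨ ⊕-congʳ _ (sumChainsOfLength-vanishes b bound (s≤s (ℕₚ.≤-trans m≤f (ℕₚ.m≤m+n f j)))) ⟨
    sumChainsUpTo b (f ℕ.+ j) x ⊕ sumChainsOfLength b (suc (f ℕ.+ j)) x    ≈⟨ sumChainsUpTo-split b (f ℕ.+ j) x ⟨
    sumChainsUpTo b (suc (f ℕ.+ j)) x                                      ∎
    where open ≋-Reasoning

  module Measured (μ : E → ℕ) (μ-dec : ∀ x y → y ∈ es → lt x y ≡ true → μ y < μ x) where

    μ<-along-chain : ∀ x l → increasing lt x l ≡ true → All (_∈ es) l → All (λ z → μ z < μ x) l
    μ<-along-chain x []      _   []             = []
    μ<-along-chain x (y ∷ l) inc (y∈es ∷ l⊆es) =
      μy<μx ∷ All.map (λ μz<μy → ℕₚ.<-trans μz<μy μy<μx) (μ<-along-chain y l (proj₂ (∧-true⁻ inc)) l⊆es)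
      where
      μy<μx = μ-dec x y y∈es (proj₁ (∧-true⁻ inc))

    chain-length≤μ : ∀ x → LengthBound x (μ x)
    chain-length≤μ x []      _              _   = z≤n
    chain-length≤μ x (y ∷ l) (y∈es ∷ l⊆es) inc = ℕₚ.≤-<-trans
      (chain-length≤μ y l l⊆es (proj₂ (∧-true⁻ inc))) (μ-dec x y y∈es (proj₁ (∧-true⁻ inc)))

    chain-unique : ∀ x l → increasing lt x l ≡ true → All (_∈ es) l → Unique l
    chain-unique x []      _   _              = []
    chain-unique x (y ∷ l) inc (y∈es ∷ l⊆es) =
      All.map (λ { μz<μy refl → ℕₚ.<-irrefl refl μz<μy }) (μ<-along-chain y l inc′ l⊆es) ∷ chain-unique y l inc′ l⊆es
      where
      inc′ = proj₂ (∧-true⁻ inc)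

    chain-length≤|es| : ∀ x → LengthBound x (length es)
    chain-length≤|es| x l l⊆es inc = pigeonhole l es (chain-unique x l inc l⊆es) l⊆es

    sumChainsUpTo-unfold : ∀ b {f x} → μ x ≤ f → sumChainsUpTo b (suc f) x ≋ sumChainsUpTo b f x
    sumChainsUpTo-unfold b {f} {x} μx≤f = ≋-trans
      (≡⇒≋ (cong (λ g → sumChainsUpTo b g x) (ℕₚ.+-comm 1 f))) (≋-sym (sumChainsUpTo-stable b 1 (chain-length≤μ x) μx≤f))

    chainSum≋sumChainsUpTo : ∀ b {f x} → μ x ≤ f → sumChainsUpTo b (length es) x ≋ sumChainsUpTo b f x
    chainSum≋sumChainsUpTo b {f} {x} μx≤f = begin
      sumChainsUpTo b (length es) x         ≈⟨ sumChainsUpTo-stable b f (chain-length≤|es| x) ℕₚ.≤-refl ⟩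
      sumChainsUpTo b (length es ℕ.+ f) x   ≡⟨ cong (λ g → sumChainsUpTo b g x) (ℕₚ.+-comm (length es) f) ⟩
      sumChainsUpTo b (f ℕ.+ length es) x   ≈⟨ sumChainsUpTo-stable b (length es) (chain-length≤μ x) μx≤f ⟨
      sumChainsUpTo b f x                   ∎
      where open ≋-Reasoning

count : {A : Set} → (A → Bool) → List A → ℕ
count p l = length (filterᵇ p l)

count-mono : {A : Set} (p q : A → Bool) (l : List A) → (∀ w → p w ≡ true → q w ≡ true) → count p l ≤ count q l
count-mono p q []      p⇒q = z≤n
count-mono p q (x ∷ l) p⇒q with p x in px | q x in qx
... | true  | true  = s≤s (count-mono p q l p⇒q)
... | true  | false = ⊥-elim (true≢false (trans (sym (p⇒q x px)) qx))
... | false | true  = ℕₚ.m≤n⇒m≤1+n (count-mono p q l p⇒q)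
... | false | false = count-mono p q l p⇒q

count-mono-< : {A : Set} (p q : A → Bool) (l : List A) {z : A} → (∀ w → p w ≡ true → q w ≡ true) →
               z ∈ l → q z ≡ true → p z ≡ false → count p l < count q l
count-mono-< p q (x ∷ l) p⇒q (here refl) qz pz rewrite pz | qz = s≤s (count-mono p q l p⇒q)
count-mono-< p q (x ∷ l) p⇒q (there z∈) qz pz with p x in px | q x in qx
... | true  | true  = s≤s (count-mono-< p q l p⇒q z∈ qz pz)
... | true  | false = ⊥-elim (true≢false (trans (sym (p⇒q x px)) qx))
... | false | true  = ℕₚ.m≤n⇒m≤1+n (count-mono-< p q l p⇒q z∈ qz pz)
... | false | false = count-mono-< p q l p⇒q z∈ qz pz

module GradedPoset {N : ℕ} (Λ : FinPoset N) (n : ℕ) (po : IsPartialOrder Λ) (graded : IsGradedOfRank Λ n) where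
  open FinPoset Λ

  ≤-refl : ∀ x → leb x x ≡ true
  ≤-refl x = T⇒≡true (proj₁ po x)

  ≤-antisym : ∀ x y → leb x y ≡ true → leb y x ≡ true → x ≡ y
  ≤-antisym x y x≤y y≤x = proj₁ (proj₂ po) x y (≡true⇒T x≤y) (≡true⇒T y≤x)

  ≤-trans : ∀ x y z → leb x y ≡ true → leb y z ≡ true → leb x z ≡ true
  ≤-trans x y z x≤y y≤z = T⇒≡true (proj₂ (proj₂ po) x y z (≡true⇒T x≤y) (≡true⇒T y≤z))

  0̂≤ : ∀ x → leb 0̂ x ≡ true
  0̂≤ x = T⇒≡true (proj₁ graded x)

  <⇒≤ : ∀ x y → ltb Λ x y ≡ true → leb x y ≡ true
  <⇒≤ x y x<y = proj₁ (∧-true⁻ x<y)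

  ≤∧≢⇒< : ∀ x y → leb x y ≡ true → x ≢ y → ltb Λ x y ≡ true
  ≤∧≢⇒< x y x≤y x≢y with x Fin.≟ y
  ... | yes x≡y = ⊥-elim (x≢y x≡y)
  ... | no  _   = ∧-true⁺ x≤y refl

  <-trans : ∀ x y z → ltb Λ x y ≡ true → ltb Λ y z ≡ true → ltb Λ x z ≡ true
  <-trans x y z x<y y<z = ≤∧≢⇒< x z (≤-trans x y z (<⇒≤ x y x<y) (<⇒≤ y z y<z)) λ { refl →
    <-irrefl x (subst (λ w → ltb Λ x w ≡ true) (≤-antisym y x (<⇒≤ y x y<z) (<⇒≤ x y x<y)) x<y) }
    where
    <-irrefl : ∀ w → ltb Λ w w ≢ true
    <-irrefl w w<w with w Fin.≟ w
    ... | yes _  = true≢false (trans (sym w<w) (∧-zeroʳ (leb w w)))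
    ... | no w≢w = w≢w refl

  ⌊≟⌋-refl : ∀ (x : Fin N) → ⌊ x Fin.≟ x ⌋ ≡ true
  ⌊≟⌋-refl x with x Fin.≟ x
  ... | yes _   = refl
  ... | no x≢x = ⊥-elim (x≢x refl)

  eqH-refl : ∀ a → eqH Λ a a ≡ true
  eqH-refl (elem x) = ⌊≟⌋-refl x
  eqH-refl top      = refl

  ≤H-trans : ∀ a b c → leH Λ a b ≡ true → leH Λ b c ≡ true → leH Λ a c ≡ true
  ≤H-trans (elem x) (elem y) (elem z) x≤y y≤z = ≤-trans x y z x≤y y≤z
  ≤H-trans (elem x) (elem y) top      _   _   = refl
  ≤H-trans (elem x) top      top      _   _   = refl
  ≤H-trans top      top      top      _   _   = refl

  ≤H-antisym : ∀ a b → leH Λ a b ≡ true → leH Λ b a ≡ true → a ≡ b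
  ≤H-antisym (elem x) (elem y) x≤y y≤x = cong elem (≤-antisym x y x≤y y≤x)
  ≤H-antisym top      top      _   _   = refl

  <H-irrefl : ∀ a → ltH Λ a a ≡ false
  <H-irrefl a rewrite eqH-refl a = ∧-zeroʳ (leH Λ a a)

  ≤H∧≢⇒<H : ∀ a b → leH Λ a b ≡ true → a ≢ b → ltH Λ a b ≡ true
  ≤H∧≢⇒<H (elem x) (elem y) x≤y x≢y with x Fin.≟ y
  ... | yes x≡y = ⊥-elim (x≢y (cong elem x≡y))
  ... | no  _   = ∧-true⁺ x≤y refl
  ≤H∧≢⇒<H (elem x) top      _   _   = refl
  ≤H∧≢⇒<H top      top      _   a≢a = ⊥-elim (a≢a refl)

  <H-trans : ∀ a b c → ltH Λ a b ≡ true → ltH Λ b c ≡ true → ltH Λ a c ≡ true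
  <H-trans a b c a<b b<c = ≤H∧≢⇒<H a c (≤H-trans a b c (proj₁ (∧-true⁻ a<b)) (proj₁ (∧-true⁻ b<c))) λ { refl →
    true≢false (trans (sym a<b) (subst (λ d → ltH Λ a d ≡ false)
      (≤H-antisym a b (proj₁ (∧-true⁻ a<b)) (proj₁ (∧-true⁻ b<c))) (<H-irrefl a))) }

  ∈hatElems : ∀ a → a ∈ hatElems Λ
  ∈hatElems (elem x) = ∈-++⁺ˡ (∈-map⁺ elem (∈-allFin x))
  ∈hatElems top      = ∈-++⁺ʳ (map elem (allFin N)) (here refl)

  strictlyBetween : Hat Λ → Hat Λ → Hat Λ → Bool
  strictlyBetween a b z = ltH Λ a z ∧ ltH Λ z b

  strictlyBetween⁻ : ∀ a b z → strictlyBetween a b z ≡ true → ltH Λ a z ≡ true × ltH Λ z b ≡ true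
  strictlyBetween⁻ a b z = ∧-true⁻ {ltH Λ a z}

  intervalSize : Hat Λ → Hat Λ → ℕ
  intervalSize a b = count (strictlyBetween a b) (hatElems Λ)

  -- Induction on the size of the open interval: an empty interval is a cover.
  ρH-mono-< : ∀ a b → ltH Λ a b ≡ true → ρH Λ n a < ρH Λ n b
  ρH-mono-< a b = go a b (<-wellFounded (intervalSize a b))
    where
    go : ∀ a b → Acc _<_ (intervalSize a b) → ltH Λ a b ≡ true → ρH Λ n a < ρH Λ n b
    go a b (acc smaller) a<b with any (strictlyBetween a b) (hatElems Λ) in some
    ... | false = ℕₚ.≤-reflexive (sym (proj₂ (proj₂ graded) a b (≡true⇒T a<b , nothing-between)))
      where
      nothing-between : ∀ z → ¬ (T (ltH Λ a z) × T (ltH Λ z b))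
      nothing-between z a<z<b = subst T some
        (any⁺ (strictlyBetween a b) (lose (∈hatElems z) (Equivalence.from T-∧ a<z<b)))
    ... | true with find (any⁻ (strictlyBetween a b) (hatElems Λ) (subst T (sym some) _))
    ... | z , z∈ , a<z<b = ℕₚ.<-trans (go a z (smaller left) a<z) (go z b (smaller right) z<b)
      where
      a<z = proj₁ (strictlyBetween⁻ a b z (T⇒≡true a<z<b))
      z<b = proj₂ (strictlyBetween⁻ a b z (T⇒≡true a<z<b))
      left : intervalSize a z < intervalSize a b
      left = count-mono-< (strictlyBetween a z) (strictlyBetween a b) (hatElems Λ)
        (λ w a<w<z → ∧-true⁺ (proj₁ (strictlyBetween⁻ a z w a<w<z)) (<H-trans w z b (proj₂ (strictlyBetween⁻ a z w a<w<z)) z<b))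
        z∈ (T⇒≡true a<z<b) (trans (cong (ltH Λ a z ∧_) (<H-irrefl z)) (∧-zeroʳ (ltH Λ a z)))
      right : intervalSize z b < intervalSize a b
      right = count-mono-< (strictlyBetween z b) (strictlyBetween a b) (hatElems Λ)
        (λ w z<w<b → ∧-true⁺ (<H-trans a z w a<z (proj₁ (strictlyBetween⁻ z b w z<w<b))) (proj₂ (strictlyBetween⁻ z b w z<w<b)))
        z∈ (T⇒≡true a<z<b) (cong (_∧ ltH Λ z b) (<H-irrefl z))

  ρ-mono-< : ∀ x y → ltb Λ x y ≡ true → ρ x < ρ y
  ρ-mono-< x y = ρH-mono-< (elem x) (elem y)

  ρ-mono-≤ : ∀ x y → leb x y ≡ true → ρ x ≤ ρ y
  ρ-mono-≤ x y x≤y with x Fin.≟ y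
  ... | yes refl = ℕₚ.≤-refl
  ... | no  x≢y  = ℕₚ.<⇒≤ (ρ-mono-< x y (≤∧≢⇒< x y x≤y x≢y))

  ρ≤n : ∀ x → ρ x ≤ n
  ρ≤n x = ℕₚ.≤-pred (ρH-mono-< (elem x) top refl)

∑-allFin-suc : ∀ k (f : Fin (suc k) → ℤ) → ∑ (allFin (suc k)) f ≡ f Fin.zero + ∑ (allFin k) (f ∘ Fin.suc)
∑-allFin-suc k f = cong (f Fin.zero +_)
  (trans (cong (sumℤ ∘ map f) (sym (Listₚ.map-tabulate (λ i → i) Fin.suc))) (∑-map (allFin k) Fin.suc f))

∑-allFin-δ : ∀ k (x : Fin k) (f : Fin k → ℤ) → ∑ (allFin k) (λ s → whenℤ ⌊ x Fin.≟ s ⌋ (f s)) ≡ f x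
∑-allFin-δ (suc k) Fin.zero    f = begin
  ∑ (allFin (suc k)) (λ s → whenℤ ⌊ Fin.zero Fin.≟ s ⌋ (f s))   ≡⟨ ∑-allFin-suc k (λ s → whenℤ ⌊ Fin.zero Fin.≟ s ⌋ (f s)) ⟩
  f Fin.zero + ∑ (allFin k) (λ _ → 0ℤ)                          ≡⟨ cong (f Fin.zero +_) (∑-zero (allFin k) (λ _ → refl)) ⟩
  f Fin.zero + 0ℤ                                               ≡⟨ ℤₚ.+-identityʳ _ ⟩
  f Fin.zero                                                    ∎
  where open ≡-Reasoning
∑-allFin-δ (suc k) (Fin.suc x) f = begin
  ∑ (allFin (suc k)) (λ s → whenℤ ⌊ Fin.suc x Fin.≟ s ⌋ (f s))
    ≡⟨ ∑-allFin-suc k (λ s → whenℤ ⌊ Fin.suc x Fin.≟ s ⌋ (f s)) ⟩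
  0ℤ + ∑ (allFin k) (λ s → whenℤ ⌊ Fin.suc x Fin.≟ Fin.suc s ⌋ (f (Fin.suc s)))  ≡⟨ ℤₚ.+-identityˡ _ ⟩
  ∑ (allFin k) (λ s → whenℤ ⌊ Fin.suc x Fin.≟ Fin.suc s ⌋ (f (Fin.suc s)))       ≡⟨ ∑-cong (allFin k) ≟-suc ⟩
  ∑ (allFin k) (λ s → whenℤ ⌊ x Fin.≟ s ⌋ (f (Fin.suc s)))                       ≡⟨ ∑-allFin-δ k x (f ∘ Fin.suc) ⟩
  f (Fin.suc x)                                                                  ∎
  where
  open ≡-Reasoning
  ≟-suc : ∀ s → whenℤ ⌊ Fin.suc x Fin.≟ Fin.suc s ⌋ (f (Fin.suc s)) ≡ whenℤ ⌊ x Fin.≟ s ⌋ (f (Fin.suc s))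
  ≟-suc s with x Fin.≟ s
  ... | yes refl = refl
  ... | no  _    = refl

sgn-suc : ∀ k → sgn (suc k) ≡ - sgn k
sgn-suc k = ℤₚ.-1*i≡-i (sgn k)

sgn-+ : ∀ j k → sgn (j ℕ.+ k) ≡ sgn j * sgn k
sgn-+ = ℤₚ.^-distribˡ-+-* -1ℤ

sgn-square : ∀ k → sgn k * sgn k ≡ 1ℤ
sgn-square zero    = refl
sgn-square (suc k) = trans (square-neg (sgn k)) (sgn-square k)
  where
  square-neg : ∀ s → (-1ℤ * s) * (-1ℤ * s) ≡ s * s
  square-neg = solve-∀

module Eulerian {N : ℕ} (Λ : FinPoset N) (n : ℕ) (po : IsPartialOrder Λ) (graded : IsGradedOfRank Λ n)
                (eulerian : IsEulerian Λ n) where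
  open FinPoset Λ
  open GradedPoset Λ n po graded

  -- The sign (-1)^ρ(σ,1̂) of σ ∈ Λ, up to the global factor -1.
  ε : Fin N → ℤ
  ε σ = sgn (n ∸ ρ σ)

  euler-to-top : ∀ z → ∑ (allFin N) (λ s → whenℤ (leb z s) (sgn (ρ s ∸ ρ z))) + sgn (suc n ∸ ρ z) ≡ 0ℤ
  euler-to-top z = begin
    ∑ (allFin N) (λ s → whenℤ (leb z s) (sgn (ρ s ∸ ρ z))) + sgn (suc n ∸ ρ z)
      ≡⟨ cong₂ _+_ (trans (∑-cong (allFin N) (λ s → cong (λ b → whenℤ b (sgn (ρ s ∸ ρ z))) (sym (∧-identityʳ (leb z s)))))
                          (sym (∑-map (allFin N) elem summand)))
                   (sym (ℤₚ.+-identityʳ _)) ⟩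
    ∑ (map elem (allFin N)) summand + ∑ (top ∷ []) summand
      ≡⟨ ∑-++ (map elem (allFin N)) (top ∷ []) summand ⟨
    ∑ (hatElems Λ) summand
      ≡⟨ ∑-filter (λ σ → leH Λ (elem z) σ ∧ leH Λ σ top) (hatElems Λ) _ ⟨
    sumℤ (map (λ σ → -1ℤ ℤ.^ (ρH Λ n σ ∸ ρ z)) (filterᵇ (λ σ → leH Λ (elem z) σ ∧ leH Λ σ top) (hatElems Λ)))
      ≡⟨ eulerian (elem z) top _ ⟩
    0ℤ ∎
    where
    open ≡-Reasoning
    summand : Hat Λ → ℤ
    summand σ = whenℤ (leH Λ (elem z) σ ∧ leH Λ σ top) (sgn (ρH Λ n σ ∸ ρ z))

  ∑ε-≥ : ∀ z → ∑ (allFin N) (λ s → whenℤ (leb z s) (ε s)) ≡ 1ℤ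
  ∑ε-≥ z = begin
    ∑ (allFin N) (λ s → whenℤ (leb z s) (ε s))                      ≡⟨ ∑-cong (allFin N) change-base ⟩
    ∑ (allFin N) (λ s → ε z * whenℤ (leb z s) (sgn (ρ s ∸ ρ z)))    ≡⟨ *-distribˡ-∑ (ε z) (allFin N) _ ⟨
    ε z * ∑ (allFin N) (λ s → whenℤ (leb z s) (sgn (ρ s ∸ ρ z)))    ≡⟨ cong (ε z *_) (x+y≡0⇒x≡-y (euler-to-top z)) ⟩
    ε z * - sgn (suc n ∸ ρ z)                                        ≡⟨ cong (λ k → ε z * - sgn k) (ℕₚ.+-∸-assoc 1 (ρ≤n z)) ⟩
    ε z * - sgn (suc (n ∸ ρ z))                                      ≡⟨ cong (λ s → ε z * - s) (sgn-suc (n ∸ ρ z)) ⟩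
    ε z * - - ε z                                                    ≡⟨ cong (ε z *_) (ℤₚ.neg-involutive (ε z)) ⟩
    ε z * ε z                                                        ≡⟨ sgn-square (n ∸ ρ z) ⟩
    1ℤ                                                               ∎
    where
    open ≡-Reasoning
    x+y≡0⇒x≡-y : ∀ {x y} → x + y ≡ 0ℤ → x ≡ - y
    x+y≡0⇒x≡-y {x} {y} x+y≡0 = trans (sym (ℤₚ.+-identityʳ x)) (trans (cong (x +_) (sym (ℤₚ.+-inverseʳ y)))
      (trans (sym (ℤₚ.+-assoc x y (- y))) (trans (cong (_+ - y) x+y≡0) (ℤₚ.+-identityˡ (- y)))))
    -- (-1)^(n-ρs) = (-1)^(n-ρz) (-1)^(ρs-ρz), since the two exponents differ by 2(ρs-ρz)
    change-base : ∀ s → whenℤ (leb z s) (ε s) ≡ ε z * whenℤ (leb z s) (sgn (ρ s ∸ ρ z))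
    change-base s with leb z s in z≤s
    ... | false = sym (ℤₚ.*-zeroʳ (ε z))
    ... | true  = begin
      ε s                                              ≡⟨ ℤₚ.*-identityʳ (ε s) ⟨
      ε s * 1ℤ                                         ≡⟨ cong (ε s *_) (sgn-square (ρ s ∸ ρ z)) ⟨
      ε s * (sgn (ρ s ∸ ρ z) * sgn (ρ s ∸ ρ z))        ≡⟨ ℤₚ.*-assoc (ε s) _ _ ⟨
      (ε s * sgn (ρ s ∸ ρ z)) * sgn (ρ s ∸ ρ z)        ≡⟨ cong (_* sgn (ρ s ∸ ρ z)) (sgn-+ (n ∸ ρ s) (ρ s ∸ ρ z)) ⟨
      sgn ((n ∸ ρ s) ℕ.+ (ρ s ∸ ρ z)) * sgn (ρ s ∸ ρ z) ≡⟨ cong (λ k → sgn k * sgn (ρ s ∸ ρ z)) (n∸ρs+ρs∸ρz≡n∸ρz (ρ-mono-≤ z s z≤s) (ρ≤n s)) ⟩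
      ε z * sgn (ρ s ∸ ρ z)                            ∎
      where
      n∸ρs+ρs∸ρz≡n∸ρz : ∀ {a b} → a ≤ b → b ≤ n → (n ∸ b) ℕ.+ (b ∸ a) ≡ n ∸ a
      n∸ρs+ρs∸ρz≡n∸ρz {a} {b} a≤b b≤n = trans (sym (ℕₚ.+-∸-assoc (n ∸ b) a≤b)) (cong (_∸ a) (ℕₚ.m∸n+n≡m b≤n))

  ∑ε-> : ∀ x → ∑ (allFin N) (λ s → whenℤ (ltb Λ x s) (ε s)) ≡ 1+sgn (suc n ∸ ρ x)
  ∑ε-> x = begin
    ∑> x                                ≡⟨ a≡a+e-e (∑> x) (ε x) ⟩
    (∑> x + ε x) + - ε x                ≡⟨ cong (λ e → (∑> x + e) + - ε x) (∑-allFin-δ N x ε) ⟨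
    (∑> x + ∑= x) + - ε x               ≡⟨ cong (_+ - ε x) (trans (sym (∑-distrib-+ (allFin N) _ _)) (∑-cong (allFin N) ≥-split)) ⟩
    ∑ (allFin N) (λ s → whenℤ (leb x s) (ε s)) + - ε x ≡⟨ cong (_+ - ε x) (∑ε-≥ x) ⟩
    1ℤ + - ε x                          ≡⟨ cong (1ℤ +_) (sgn-suc (n ∸ ρ x)) ⟨
    1+sgn (suc (n ∸ ρ x))               ≡⟨ cong 1+sgn (ℕₚ.+-∸-assoc 1 (ρ≤n x)) ⟨
    1+sgn (suc n ∸ ρ x)                 ∎
    where
    open ≡-Reasoning
    ∑> ∑= : Fin N → ℤ
    ∑> x = ∑ (allFin N) (λ s → whenℤ (ltb Λ x s) (ε s))
    ∑= x = ∑ (allFin N) (λ s → whenℤ ⌊ x Fin.≟ s ⌋ (ε s))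
    a≡a+e-e : ∀ a e → a ≡ (a + e) + - e
    a≡a+e-e = solve-∀
    ≥-split : ∀ s → whenℤ (ltb Λ x s) (ε s) + whenℤ ⌊ x Fin.≟ s ⌋ (ε s) ≡ whenℤ (leb x s) (ε s)
    ≥-split s with leb x s in x≤s | x Fin.≟ s
    ... | true  | yes _    = ℤₚ.+-identityˡ (ε s)
    ... | true  | no  _    = ℤₚ.+-identityʳ (ε s)
    ... | false | yes refl = ⊥-elim (true≢false (trans (sym (≤-refl x)) x≤s))
    ... | false | no  _    = refl

module Setting {N : ℕ} (Λ : FinPoset N) (n : ℕ) (po : IsPartialOrder Λ) (graded : IsGradedOfRank Λ n)
               (lattice : IsLattice Λ) (eulerian : IsEulerian Λ n) (ν : Fin N) (ν≢0̂ : ν ≢ FinPoset.0̂ Λ) where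
  open FinPoset Λ
  open GradedPoset Λ n po graded
  open Eulerian Λ n po graded eulerian

  inΛν-intro : ∀ x π → leb x π ≡ true → leb ν π ≡ true → inΛν Λ ν x ≡ true
  inΛν-intro x π x≤π ν≤π with proj₁ (lattice (elem x) (elem ν))
  ... | top    , _   , _   , least = ⊥-elim (least (elem π) (≡true⇒T x≤π) (≡true⇒T ν≤π))
  ... | elem z , x≤z , ν≤z , least = T⇒≡true (any⁺ _ (lose (∈-allFin z)
        (Equivalence.from T-∧ (x≤z , Equivalence.from T-∧ (ν≤z , all⁻ _ {xs = hatElems Λ} (All.tabulate (λ {w} _ → least-at w)))))))
    where
    least-at : ∀ w → T (not (leH Λ (elem x) w ∧ leH Λ (elem ν) w) ∨ leH Λ (elem z) w)
    least-at w with leH Λ (elem x) w in x≤w | leH Λ (elem ν) w in ν≤w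
    ... | true  | true  = least w (≡true⇒T x≤w) (≡true⇒T ν≤w)
    ... | true  | false = _
    ... | false | _     = _

  -- The join z = x ∨ ν exists in Λ; and since ν ≰ x, z ≠ x, so {π : ν ≤ π, x < π} = {π : z ≤ π}.
  above-join : ∀ x → inΛν Λ ν x ≡ true → leb ν x ≡ false → ∃ λ z → ∀ π → (leb ν π ∧ ltb Λ x π) ≡ leb z π
  above-join x x∈Λν ν≰x with find (any⁻ _ (allFin N) (≡true⇒T x∈Λν))
  ... | z , _ , isJoin with Equivalence.to T-∧ isJoin
  ... | x≤z , rest with Equivalence.to T-∧ rest
  ... | ν≤z , least = z , same
    where
    least-at : ∀ π → T (not (leb x π ∧ leb ν π) ∨ leb z π)
    least-at π = All.lookup (all⁺ _ (hatElems Λ) least) (∈hatElems (elem π))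
    same : ∀ π → (leb ν π ∧ ltb Λ x π) ≡ leb z π
    same π with leb z π in z≤π
    ... | true  = ∧-true⁺ (≤-trans ν z π (T⇒≡true ν≤z) z≤π) (≤∧≢⇒< x π (≤-trans x z π (T⇒≡true x≤z) z≤π)
                    λ { refl → true≢false (trans (sym (≤-trans ν z x (T⇒≡true ν≤z) z≤π)) ν≰x) })
    ... | false with leb ν π in ν≤π | ltb Λ x π in x<π
    ... | false | _     = refl
    ... | true  | false = refl
    ... | true  | true  = ⊥-elim (subst T not-least (least-at π))
      where
      not-least : not (leb x π ∧ leb ν π) ∨ leb z π ≡ false
      not-least rewrite <⇒≤ x π x<π | ν≤π | z≤π = refl

  ν≰0̂ : leb ν 0̂ ≡ false
  ν≰0̂ with leb ν 0̂ in ν≤0̂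
  ... | false = refl
  ... | true  = ⊥-elim (ν≢0̂ (≤-antisym ν 0̂ ν≤0̂ (0̂≤ ν)))

  0̂∈Λν : inΛν Λ ν 0̂ ≡ true
  0̂∈Λν = inΛν-intro 0̂ ν (0̂≤ ν) (≤-refl ν)

  step : Fin N → Fin N → Poly
  step x y = 𝐀-𝐁 ^P ((ρ y ∸ ρ x) ∸ 1) ⊗ 𝐁

  below : Fin N → List (Fin N)
  below π = filterᵇ (λ σ → ltb Λ σ π) (allFin N)

  -- chainsFrom x sums the chains of [x, π) starting at x, i.e. it is Ψ of [x, π).
  module Ψ (π : Fin N) where
    open ChainSums (below π) (ltb Λ) ρ (ρ π) (λ _ → false) public hiding (step)
    open Measured (λ x → ρ π ∸ ρ x)
      (λ x y y∈ x<y → ℕₚ.∸-monoʳ-< (ρ-mono-< x y x<y) (ρ-mono-≤ y π (<⇒≤ y π (∈-filterᵇ⁻ _ (allFin N) y∈)))) public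

    chainsFrom : Fin N → Poly
    chainsFrom = sumChainsUpTo true (suc n)

    ρπ∸ρx≤1+n : ∀ x → ρ π ∸ ρ x ≤ suc n
    ρπ∸ρx≤1+n x = ℕₚ.≤-trans (ℕₚ.m∸n≤m (ρ π) (ρ x)) (ℕₚ.m≤n⇒m≤1+n (ρ≤n π))

    Ψbelow≋chainsFrom-0̂ : Ψbelow Λ π ≋ chainsFrom 0̂
    Ψbelow≋chainsFrom-0̂ = chainSum≋sumChainsUpTo true (ρπ∸ρx≤1+n 0̂)

    chainsFrom-rec : ∀ x → chainsFrom x ≋
      final x ⊕ ⨁ (allFin N) (λ y → when (ltb Λ y π) (when (ltb Λ x y) (step x y ⊗ chainsFrom y)))
    chainsFrom-rec x = ≋-trans (≋-sym (sumChainsUpTo-unfold true (ρπ∸ρx≤1+n x))) (≋-trans (sumChainsUpTo-suc true (suc n) x)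
      (⊕-congʳ (final x) (⨁-filter (λ σ → ltb Λ σ π) (allFin N) (λ y → when (ltb Λ x y) (step x y ⊗ chainsFrom y)))))

  module Λ′ = ChainSums (Λ'elems Λ ν) (lt' Λ ν) (ρ' Λ n) (suc n) (isStar Λ)

  μ′ : Star Λ → ℕ
  μ′ (old x) = suc (n ∸ ρ x)
  μ′ star    = 0

  μ′-dec : ∀ a b → b ∈ Λ'elems Λ ν → lt' Λ ν a b ≡ true → μ′ b < μ′ a
  μ′-dec (old x) (old y) _ x<y = s≤s (ℕₚ.∸-monoʳ-< (ρ-mono-< x y x<y) (ρ≤n y))
  μ′-dec (old x) star    _ _   = s≤s z≤n

  open Λ′.Measured μ′ μ′-dec using (chainSum≋sumChainsUpTo; sumChainsUpTo-unfold)

  toStar : Fin N → Poly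
  toStar x = 𝐀-𝐁 ^P ((n ∸ ρ x) ∸ 1) ⊗ 𝐁

  finalStar≋1 : Λ′.final star ≋ oneP
  finalStar≋1 = ≡⇒≋ (cong (λ k → 𝐀-𝐁 ^P (k ∸ 1)) (ℕₚ.m+n∸n≡m 1 n))

  chainsFromStar : ∀ f → Λ′.sumChainsUpTo true f star ≋ oneP
  chainsFromStar zero    = ≋-trans (Λ′.sumChainsOfLength-zero true star) finalStar≋1
  chainsFromStar (suc f) = ≋-trans (Λ′.sumChainsUpTo-suc true f star)
    (≋-trans (⊕-congʳ (Λ′.final star) (⨁-zero (Λ'elems Λ ν) (λ _ → ≋-refl))) (≋-trans (⊕-identityʳ (Λ′.final star)) finalStar≋1))

  throughStarWithin : ℕ → Fin N → Poly
  throughStarWithin f x = Λ′.sumChainsUpTo false f (old x)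

  throughStarWithin-suc : ∀ f x → throughStarWithin (suc f) x ≋
    when (inΛν Λ ν x ∧ not (leb ν x)) (toStar x)
      ⊕ ⨁ (allFin N) (λ y → when (inΛν Λ ν y) (when (ltb Λ x y) (step x y ⊗ throughStarWithin f y)))
  throughStarWithin-suc f x =
    ≋-trans (Λ′.sumChainsUpTo-suc false f (old x)) (⊕-cong
      (when-cong (inΛν Λ ν x ∧ not (leb ν x)) (λ _ → ≋-trans (⊗-congʳ (toStar x) (chainsFromStar f)) (⊗-identityʳ (toStar x))))
      (≋-trans (≡⇒≋ (⨁-map (filterᵇ (inΛν Λ ν) (allFin N)) old _)) (⨁-filter (inΛν Λ ν) (allFin N) _)))

  throughStarWithin-vanishes : ∀ f x → leb ν x ≡ true → throughStarWithin f x ≋ zeroP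
  throughStarWithin-vanishes zero    x ν≤x = ≋-refl
  throughStarWithin-vanishes (suc f) x ν≤x = ≋-trans (throughStarWithin-suc f x)
    (≋-trans (⊕-cong (when-false _ (toStar x) never) (⨁-zero (allFin N) above)) (⊕-identityʳ zeroP))
    where
    never : inΛν Λ ν x ∧ not (leb ν x) ≢ true
    never rewrite ν≤x | ∧-zeroʳ (inΛν Λ ν x) = true≢false ∘ sym
    above : ∀ y → when (inΛν Λ ν y) (when (ltb Λ x y) (step x y ⊗ throughStarWithin f y)) ≋ zeroP
    above y with inΛν Λ ν y | ltb Λ x y in x<y
    ... | false | _     = ≋-refl
    ... | true  | false = ≋-refl
    ... | true  | true  = ≋-trans (⊗-congʳ (step x y) (throughStarWithin-vanishes f y (≤-trans ν x y ν≤x (<⇒≤ x y x<y))))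
                                  (⊗-zeroʳ (step x y))

  throughStar : Fin N → Poly
  throughStar = throughStarWithin (suc n)

  LHS≋throughStar-0̂ : LHS Λ n ν ≋ throughStar 0̂
  LHS≋throughStar-0̂ = chainSum≋sumChainsUpTo false (s≤s (ℕₚ.m∸n≤m n (ρ 0̂)))

  throughStar-rec : ∀ x → throughStar x ≋
    when (inΛν Λ ν x ∧ not (leb ν x)) (toStar x)
      ⊕ ⨁ (allFin N) (λ y → when (inΛν Λ ν y) (when (ltb Λ x y) (step x y ⊗ throughStar y)))
  throughStar-rec x = ≋-trans (≋-sym (sumChainsUpTo-unfold false (s≤s (ℕₚ.m∸n≤m n (ρ x))))) (throughStarWithin-suc (suc n) x)

  factor : Fin N → Poly
  factor π = bracket (suc n ∸ ρ π)

  aboveν : Fin N → Fin N → Bool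
  aboveν x π = leb ν π ∧ ltb Λ x π

  aboveν⁻ : ∀ x π → aboveν x π ≡ true → leb ν π ≡ true × ltb Λ x π ≡ true
  aboveν⁻ x π = ∧-true⁻ {leb ν π}

  rhsFrom : Fin N → Poly
  rhsFrom x = ⨁ (allFin N) (λ π → when (aboveν x π) ((Ψ.chainsFrom π x ⊗ factor π) ⊗ 𝐁))

  RHS≋rhsFrom-0̂ : RHS Λ n ν ≋ rhsFrom 0̂
  RHS≋rhsFrom-0̂ = ≋-trans (⨁-filter (leb ν) (allFin N) (RHSterm Λ n)) (⨁-cong (allFin N) same-term)
    where
    same-term : ∀ π → when (leb ν π) (RHSterm Λ n π) ≋ when (aboveν 0̂ π) ((Ψ.chainsFrom π 0̂ ⊗ factor π) ⊗ 𝐁)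
    same-term π with leb ν π in ν≤π
    ... | false = ≋-refl
    ... | true rewrite ≤∧≢⇒< 0̂ π (0̂≤ π) (λ { refl → true≢false (trans (sym ν≤π) ν≰0̂) }) =
      ⊗-congˡ 𝐁 (⊗-congˡ (factor π) (Ψ.Ψbelow≋chainsFrom-0̂ π))

  direct : Fin N → Poly
  direct x = ⨁ (allFin N) (λ π → when (aboveν x π) ((Ψ.final π x ⊗ factor π) ⊗ 𝐁))

  rhsTerm : Fin N → Fin N → Poly
  rhsTerm π x = (Ψ.chainsFrom π x ⊗ factor π) ⊗ 𝐁

  rhsTerm-split : ∀ x π → when (aboveν x π) (rhsTerm π x) ≋
    when (aboveν x π) ((Ψ.final π x ⊗ factor π) ⊗ 𝐁)
      ⊕ ⨁ (allFin N) (λ y → when (ltb Λ x y) (when (aboveν y π) (step x y ⊗ rhsTerm π y)))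
  rhsTerm-split x π = begin
    when c (rhsTerm π x)
      ≈⟨ when-cong c (λ _ → ⊗-congˡ 𝐁 (⊗-congˡ (factor π) (Ψ.chainsFrom-rec π x))) ⟩
    when c (((Ψ.final π x ⊕ later) ⊗ factor π) ⊗ 𝐁)
      ≈⟨ when-cong c (λ _ → ≋-trans (⊗-congˡ 𝐁 (⊗-distribʳ-⊕ (Ψ.final π x) later (factor π)))
                                    (⊗-distribʳ-⊕ (Ψ.final π x ⊗ factor π) (later ⊗ factor π) 𝐁)) ⟩
    when c ((Ψ.final π x ⊗ factor π) ⊗ 𝐁 ⊕ (later ⊗ factor π) ⊗ 𝐁)
      ≈⟨ when-distrib-⊕ c _ _ ⟩
    when c ((Ψ.final π x ⊗ factor π) ⊗ 𝐁) ⊕ when c ((later ⊗ factor π) ⊗ 𝐁)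
      ≈⟨ ⊕-congʳ _ (≋-trans (when-cong c (λ _ → ≋-trans (⊗-congˡ 𝐁 (⊗-distribʳ-⨁ (factor π) (allFin N) laterVia))
                                                         (⊗-distribʳ-⨁ 𝐁 (allFin N) (λ y → laterVia y ⊗ factor π))))
                             (≋-trans (when-⨁ c (allFin N) _) (⨁-cong (allFin N) reorder))) ⟩
    when c ((Ψ.final π x ⊗ factor π) ⊗ 𝐁) ⊕ ⨁ (allFin N) (λ y → when (ltb Λ x y) (when (aboveν y π) (step x y ⊗ rhsTerm π y))) ∎
    where
    open ≋-Reasoning
    c : Bool
    c = aboveν x π
    laterVia : Fin N → Poly
    laterVia y = when (ltb Λ y π) (when (ltb Λ x y) (step x y ⊗ Ψ.chainsFrom π y))
    later : Poly
    later = ⨁ (allFin N) laterVia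
    reorder : ∀ y → when c ((laterVia y ⊗ factor π) ⊗ 𝐁) ≋ when (ltb Λ x y) (when (aboveν y π) (step x y ⊗ rhsTerm π y))
    reorder y with ltb Λ x y in x<y | ltb Λ y π in y<π
    ... | true  | true  rewrite <-trans x y π x<y y<π = when-cong (leb ν π ∧ true) λ _ →
      ≋-trans (⊗-congˡ 𝐁 (⊗-assoc (step x y) (Ψ.chainsFrom π y) (factor π))) (⊗-assoc (step x y) _ 𝐁)
    ... | true  | false rewrite ∧-zeroʳ (leb ν π) = when-zero c
    ... | false | true  = when-zero c
    ... | false | false = when-zero c

  rhsFrom-rec : ∀ x → rhsFrom x ≋ direct x ⊕ ⨁ (allFin N) (λ y → when (ltb Λ x y) (step x y ⊗ rhsFrom y))
  rhsFrom-rec x = begin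
    rhsFrom x
      ≈⟨ ⨁-cong (allFin N) (rhsTerm-split x) ⟩
    ⨁ (allFin N) (λ π → when (aboveν x π) ((Ψ.final π x ⊗ factor π) ⊗ 𝐁) ⊕ ⨁ (allFin N) (λ y → through π y))
      ≈⟨ ⨁-distrib-⊕ (allFin N) _ _ ⟩
    direct x ⊕ ⨁ (allFin N) (λ π → ⨁ (allFin N) (λ y → through π y))
      ≈⟨ ⊕-congʳ (direct x) (⨁-comm (allFin N) (allFin N) through) ⟩
    direct x ⊕ ⨁ (allFin N) (λ y → ⨁ (allFin N) (λ π → through π y))
      ≈⟨ ⊕-congʳ (direct x) (⨁-cong (allFin N) factor-out) ⟩
    direct x ⊕ ⨁ (allFin N) (λ y → when (ltb Λ x y) (step x y ⊗ rhsFrom y)) ∎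
    where
    open ≋-Reasoning
    through : Fin N → Fin N → Poly
    through π y = when (ltb Λ x y) (when (aboveν y π) (step x y ⊗ rhsTerm π y))
    factor-out : ∀ y → ⨁ (allFin N) (λ π → through π y) ≋ when (ltb Λ x y) (step x y ⊗ rhsFrom y)
    factor-out y = ≋-sym (≋-trans (when-cong (ltb Λ x y) (λ _ →
      ≋-trans (⊗-distribˡ-⨁ (step x y) (allFin N) _) (⨁-cong (allFin N) (λ π → ⊗-when (aboveν y π) (step x y) (rhsTerm π y)))))
      (when-⨁ (ltb Λ x y) (allFin N) _))

  coefficient : Fin N → ℤ
  coefficient y = 1+sgn (suc n ∸ ρ y)

  -- bracket-telescope with j = ρ(x,π) - 1 and m = ρ(π,1̂) - 1.
  telescope : ∀ x π → ltb Λ x π ≡ true →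
    (Ψ.final π x ⊗ factor π) ⊗ 𝐁 ⊕ step x π ⊗ scale (coefficient π) (toStar π) ≋ scale (ε π) (toStar x)
  telescope x π x<π rewrite ℕₚ.+-∸-assoc 1 (ρ≤n π) = ≋-trans (bracket-telescope j m)
    (≡⇒≋ (cong (λ k → scale (sgn m) (𝐀-𝐁 ^P k ⊗ 𝐁)) j+m≡n∸ρx∸1))
    where
    j m : ℕ
    j = (ρ π ∸ ρ x) ∸ 1
    m = n ∸ ρ π
    j+m≡n∸ρx∸1 : j ℕ.+ m ≡ (n ∸ ρ x) ∸ 1
    j+m≡n∸ρx∸1 = begin
      (ρ π ∸ ρ x) ∸ 1 ℕ.+ (n ∸ ρ π) ≡⟨ cong (ℕ._+ m) (ℕₚ.∸-+-assoc (ρ π) (ρ x) 1) ⟩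
      ρ π ∸ ρx+1 ℕ.+ (n ∸ ρ π)      ≡⟨ ℕₚ.+-comm (ρ π ∸ ρx+1) m ⟩
      (n ∸ ρ π) ℕ.+ (ρ π ∸ ρx+1)    ≡⟨ ℕₚ.+-∸-assoc m ρx+1≤ρπ ⟨
      (n ∸ ρ π) ℕ.+ ρ π ∸ ρx+1      ≡⟨ cong (_∸ ρx+1) (ℕₚ.m∸n+n≡m (ρ≤n π)) ⟩
      n ∸ ρx+1                      ≡⟨ ℕₚ.∸-+-assoc n (ρ x) 1 ⟨
      (n ∸ ρ x) ∸ 1                 ∎
      where
      open ≡-Reasoning
      ρx+1 = ρ x ℕ.+ 1
      ρx+1≤ρπ : ρx+1 ≤ ρ π
      ρx+1≤ρπ = ℕₚ.≤-trans (ℕₚ.≤-reflexive (ℕₚ.+-comm (ρ x) 1)) (ρ-mono-< x π x<π)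

  collapse : ∀ x → (∀ y → aboveν x y ≡ true → rhsFrom y ≋ scale (coefficient y) (toStar y)) →
    direct x ⊕ ⨁ (allFin N) (λ y → when (aboveν x y) (step x y ⊗ rhsFrom y))
      ≋ scale (∑ (allFin N) (λ π → whenℤ (aboveν x π) (ε π))) (toStar x)
  collapse x ih = begin
    direct x ⊕ ⨁ (allFin N) (λ y → when (aboveν x y) (step x y ⊗ rhsFrom y))
      ≈⟨ ⨁-distrib-⊕ (allFin N) _ _ ⟨
    ⨁ (allFin N) (λ π → when (aboveν x π) ((Ψ.final π x ⊗ factor π) ⊗ 𝐁) ⊕ when (aboveν x π) (step x π ⊗ rhsFrom π))
      ≈⟨ ⨁-cong (allFin N) (λ π → ≋-trans (≋-sym (when-distrib-⊕ (aboveν x π) _ _)) (when-cong (aboveν x π) (per-π π))) ⟩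
    ⨁ (allFin N) (λ π → when (aboveν x π) (scale (ε π) (toStar x)))
      ≈⟨ ⨁-cong (allFin N) (λ π → when-scale (aboveν x π) (ε π) (toStar x)) ⟩
    ⨁ (allFin N) (λ π → scale (whenℤ (aboveν x π) (ε π)) (toStar x))
      ≈⟨ ⨁-scale (allFin N) _ (toStar x) ⟩
    scale (∑ (allFin N) (λ π → whenℤ (aboveν x π) (ε π))) (toStar x) ∎
    where
    open ≋-Reasoning
    per-π : ∀ π → aboveν x π ≡ true →
      (Ψ.final π x ⊗ factor π) ⊗ 𝐁 ⊕ step x π ⊗ rhsFrom π ≋ scale (ε π) (toStar x)
    per-π π above = ≋-trans (⊕-congʳ _ (⊗-congʳ (step x π) (ih π above)))
                            (telescope x π (proj₂ (aboveν⁻ x π above)))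

  rhsFrom-vanishes : ∀ y → inΛν Λ ν y ≡ false → rhsFrom y ≋ zeroP
  rhsFrom-vanishes y y∉Λν = ⨁-zero (allFin N) (λ π → when-false (aboveν y π) _ λ above →
    true≢false (trans (sym (inΛν-intro y π (<⇒≤ y π (proj₂ (aboveν⁻ y π above))) (proj₁ (aboveν⁻ y π above)))) y∉Λν))

  AboveClaim OffClaim : Fin N → Set
  AboveClaim y = leb ν y ≡ true → rhsFrom y ≋ scale (coefficient y) (toStar y)
  OffClaim   y = inΛν Λ ν y ≡ true → leb ν y ≡ false → rhsFrom y ≋ throughStar y

  above-claim : ∀ x → (∀ y → ltb Λ x y ≡ true → AboveClaim y) → AboveClaim x
  above-claim x ih ν≤x = begin
    rhsFrom x
      ≈⟨ rhsFrom-rec x ⟩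
    direct x ⊕ ⨁ (allFin N) (λ y → when (ltb Λ x y) (step x y ⊗ rhsFrom y))
      ≈⟨ ⊕-congʳ (direct x) (⨁-cong (allFin N) (λ y → ≡⇒≋ (cong (λ b → when b (step x y ⊗ rhsFrom y)) (sym (aboveν≡< y))))) ⟩
    direct x ⊕ ⨁ (allFin N) (λ y → when (aboveν x y) (step x y ⊗ rhsFrom y))
      ≈⟨ collapse x (λ y above → ih y (proj₂ (aboveν⁻ x y above)) (proj₁ (aboveν⁻ x y above))) ⟩
    scale (∑ (allFin N) (λ π → whenℤ (aboveν x π) (ε π))) (toStar x)
      ≡⟨ cong (λ k → scale k (toStar x)) (trans (∑-cong (allFin N) (λ π → cong (λ b → whenℤ b (ε π)) (aboveν≡< π))) (∑ε-> x)) ⟩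
    scale (coefficient x) (toStar x) ∎
    where
    open ≋-Reasoning
    aboveν≡< : ∀ π → aboveν x π ≡ ltb Λ x π
    aboveν≡< π with ltb Λ x π in x<π
    ... | true  = ∧-true⁺ (≤-trans ν x π ν≤x (<⇒≤ x π x<π)) refl
    ... | false = ∧-zeroʳ (leb ν π)

  off-claim : ∀ x → (∀ y → ltb Λ x y ≡ true → AboveClaim y × OffClaim y) → OffClaim x
  off-claim x ih x∈Λν ν≰x with above-join x x∈Λν ν≰x
  ... | z , above⇔≥z = begin
    rhsFrom x
      ≈⟨ rhsFrom-rec x ⟩
    direct x ⊕ ⨁ (allFin N) (λ y → when (ltb Λ x y) (step x y ⊗ rhsFrom y))
      ≈⟨ ⊕-congʳ (direct x) (≋-trans (⨁-cong (allFin N) split) (⨁-distrib-⊕ (allFin N) _ _)) ⟩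
    direct x ⊕ (⨁ (allFin N) (λ y → when (aboveν x y) (step x y ⊗ rhsFrom y)) ⊕ offν)
      ≈⟨ ⊕-assoc (direct x) _ offν ⟨
    (direct x ⊕ ⨁ (allFin N) (λ y → when (aboveν x y) (step x y ⊗ rhsFrom y))) ⊕ offν
      ≈⟨ ⊕-congˡ offν (collapse x (λ y above → proj₁ (ih y (proj₂ (aboveν⁻ x y above))) (proj₁ (aboveν⁻ x y above)))) ⟩
    scale (∑ (allFin N) (λ π → whenℤ (aboveν x π) (ε π))) (toStar x) ⊕ offν
      ≡⟨ cong (λ k → scale k (toStar x) ⊕ offν)
              (trans (∑-cong (allFin N) (λ π → cong (λ b → whenℤ b (ε π)) (above⇔≥z π))) (∑ε-≥ z)) ⟩
    scale 1ℤ (toStar x) ⊕ offν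
      ≈⟨ ⊕-congˡ offν (scale-identity (toStar x)) ⟩
    toStar x ⊕ offν
      ≡⟨ cong (λ b → when b (toStar x) ⊕ offν) (cong₂ (λ a b → a ∧ not b) x∈Λν ν≰x) ⟨
    when (inΛν Λ ν x ∧ not (leb ν x)) (toStar x) ⊕ offν
      ≈⟨ throughStar-rec x ⟨
    throughStar x ∎
    where
    open ≋-Reasoning
    offν : Poly
    offν = ⨁ (allFin N) (λ y → when (inΛν Λ ν y) (when (ltb Λ x y) (step x y ⊗ throughStar y)))
    split : ∀ y → when (ltb Λ x y) (step x y ⊗ rhsFrom y) ≋
      when (leb ν y ∧ ltb Λ x y) (step x y ⊗ rhsFrom y) ⊕ when (inΛν Λ ν y) (when (ltb Λ x y) (step x y ⊗ throughStar y))
    split y with ltb Λ x y in x<y | leb ν y in ν≤y | inΛν Λ ν y in y∈Λν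
    ... | false | ν≤y′  | y∈Λν′ rewrite ∧-zeroʳ ν≤y′ = ≋-sym (when-zero y∈Λν′)
    ... | true  | true  | true  = ≋-sym (≋-trans (⊕-congʳ _ (≋-trans (⊗-congʳ (step x y)
                                    (throughStarWithin-vanishes (suc n) y ν≤y)) (⊗-zeroʳ (step x y)))) (⊕-identityʳ _))
    ... | true  | true  | false = ≋-sym (⊕-identityʳ _)
    ... | true  | false | true  = ⊗-congʳ (step x y) (proj₂ (ih y x<y) y∈Λν ν≤y)
    ... | true  | false | false = ≋-trans (⊗-congʳ (step x y) (rhsFrom-vanishes y y∈Λν)) (⊗-zeroʳ (step x y))

  claims : ∀ x → AboveClaim x × OffClaim x
  claims x = go x (<-wellFounded (n ∸ ρ x))
    where
    go : ∀ x → Acc _<_ (n ∸ ρ x) → AboveClaim x × OffClaim x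
    go x (acc smaller) = above-claim x (λ y x<y → proj₁ (ih y x<y)) , off-claim x ih
      where
      ih : ∀ y → ltb Λ x y ≡ true → AboveClaim y × OffClaim y
      ih y x<y = go y (smaller (ℕₚ.∸-monoʳ-< (ρ-mono-< x y x<y) (ρ≤n y)))

  LHS≋RHS : LHS Λ n ν ≋ RHS Λ n ν
  LHS≋RHS = begin
    LHS Λ n ν       ≈⟨ LHS≋throughStar-0̂ ⟩
    throughStar 0̂   ≈⟨ proj₂ (claims 0̂) 0̂∈Λν ν≰0̂ ⟨
    rhsFrom 0̂       ≈⟨ RHS≋rhsFrom-0̂ ⟨
    RHS Λ n ν       ∎
    where open ≋-Reasoning

proposition3p3 : (N n : ℕ) (Λ : FinPoset N) →
    IsPartialOrder Λ → IsGradedOfRank Λ n → IsLattice Λ → IsEulerian Λ n →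
    (ν : Fin N) → ν ≢ FinPoset.0̂ Λ →
    LHS Λ n ν ≈ RHS Λ n ν
proposition3p3 N n Λ po graded lattice eulerian ν ν≢0̂ =
  coeff≡ (Setting.LHS≋RHS Λ n po graded lattice eulerian ν ν≢0̂)
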